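{- Let $\Gamma$ be a pure graph, $v_0$ an articulation vertex of $\Gamma$, and $(\Gamma_1,\Gamma_2)$ a split of $\Gamma$ with respect to $v_0$. Then the map $\sigma\colon\mathbf{QD}_{v_0}(\Gamma_1)\times\mathbf{QD}_{v_0}(\Gamma_2)\to\mathbf{QD}_{v_0}(\Gamma)$, $((\mathcal E_1,D_1),(\mathcal E_2,D_2))\mapsto(\mathcal E_1\cup\mathcal E_2,D_1+D_2+v_0)$, is an isomorphism of posets (product order on the source). Moreover, if $e\in E(\Gamma_1)$, $(\mathcal E,D)\in\mathbf{QD}_{v_0}(\Gamma)$ with $e\in\mathcal E$, $\sigma^{ -1}(\mathcal E,D)=((\mathcal E_1,D_1),(\mathcal E_2,D_2))$, and $(\mathcal E\setminus\{e\},\overline D)\in\mathbf{QD}_{v_0}(\Gamma)$ satisfies $(\mathcal E\setminus\{e\},\overline D)\le(\mathcal E,D)$, then $\sigma^{ -1}(\mathcal E\setminus\{e\},\overline D)=((\mathcal E_1\setminus\{e\},\overline D_1),(\mathcal E_2,D_2))$ for some $\overline D_1$ with $(\mathcal E_1\setminus\{e\},\overline D_1)\in\mathbf{QD}_{v_0}(\Gamma_1)$ and $(\mathcal E_1\setminus\{e\},\overline D_1)\le(\mathcal E_1,D_1)$.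
   Context: Graphs are finite, loops and multiple edges allowed; pure means all weights are 0, genus $g=b_1(\Gamma)$; $\mathrm{val}(v)$ counts loops twice. An articulation vertex is a vertex whose removal disconnects the graph. A split of $\Gamma$ with respect to an articulation vertex $v_0$ is a pair of connected subgraphs $(\Gamma_1,\Gamma_2)$, each with at least one edge, with $V(\Gamma_1)\cap V(\Gamma_2)=\{v_0\}$, $V(\Gamma_1)\cup V(\Gamma_2)=V(\Gamma)$, $E(\Gamma_1)\cap E(\Gamma_2)=\emptyset$, $E(\Gamma_1)\cup E(\Gamma_2)=E(\Gamma)$. For $\mathcal E\subset E(\Gamma)$, $\Gamma^{\mathcal E}$ is obtained by inserting one vertex $v_e$ in each $e\in\mathcal E$. A pseudo-divisor is $(\mathcal E,D)$ with $D\colon V(\Gamma^{\mathcal E})\to\mathbb Z$, $D(v_e)=1$ for $e\in\mathcal E$; divisors on $\Gamma_i^{\mathcal E_i}$ are viewed as divisors on $\Gamma^{\mathcal E_1\cup\mathcal E_2}$ by extension by zero, and $+v_0$ adds 1 at $v_0$. Order: $(\mathcal E,D)\ge(\mathcal E',D')$ iff $\mathcal E'\subset\mathcal E$ and there is $\varphi\colon\mathcal E\setminus\mathcal E'\to V(\Gamma)$, $\varphi(e)$ an end-vertex of $e$, with $D'(v)=D(v)+|\varphi^{ -1}(v)|$ for $v\in V(\Gamma)$. For a graph $G$ (here $\Gamma,\Gamma_1,\Gamma_2$), with $\mu(v)=-1+\mathrm{val}_G(v)/2$ on $V(G)$ and $0$ on exceptional vertices, $(\mathcal E,D)$ of degree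 $g_G-1$ is $v_0$-quasistable if $D(V)-\mu(V)+\delta_V/2\ge0$ for all nonempty $V\subset V(G^{\mathcal E})$, strictly when $v_0\notin V$ ($\delta_V$ = number of edges of $G^{\mathcal E}$ between $V$ and its complement); $\mathbf{QD}_{v_0}(G)$ is the poset of these. -}

module Defs where

open import Data.Nat using (ℕ; zero; suc)
import Data.Nat as ℕ
open import Data.Integer using (ℤ; +_; 0ℤ; 1ℤ; _+_; _-_; _*_; _≤_; _<_)
open import Data.Bool using (Bool; true; false; if_then_else_; _∧_; not; _xor_)
open import Data.Fin using (Fin; zero; suc; _≟_)
open import Data.Fin.Subset using (Subset; _∈_; _∉_; _⊆_; _∪_; _─_; ∣_∣; Nonempty; ⊤; ⁅_⁆; _∩_)
open import Data.Fin.Subset.Properties using (_∈?_)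
open import Data.Product using (Σ; _×_; _,_; ∃; ∃-syntax)
open import Data.Sum using (_⊎_)
open import Relation.Nullary using (¬_)
open import Relation.Nullary.Decidable using (⌊_⌋)
open import Relation.Binary.PropositionalEquality using (_≡_; _≢_)

Σℤ : ∀ {k} → (Fin k → ℤ) → ℤ
Σℤ {zero}  f = 0ℤ
Σℤ {suc k} f = f zero + Σℤ (λ i → f (suc i))

Σℕ : ∀ {k} → (Fin k → ℕ) → ℕ
Σℕ {zero}  f = 0
Σℕ {suc k} f = f zero ℕ.+ Σℕ (λ i → f (suc i))

_∈ᵇ_ : ∀ {k} → Fin k → Subset k → Bool
x ∈ᵇ p = ⌊ x ∈? p ⌋

_==_ : ∀ {k} → Fin k → Fin k → Bool
x == y = ⌊ x ≟ y ⌋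

[_] : Bool → ℕ
[ b ] = if b then 1 else 0

-- Finite graphs (loops and multiple edges allowed).  All graphs are pure (weights 0), so
-- no weight function is recorded.

record Graph : Set where
  field
    nV  : ℕ
    nE  : ℕ
    src : Fin nE → Fin nV
    tgt : Fin nE → Fin nV
open Graph public

record Subgraph (Γ : Graph) : Set where
  field
    Vs     : Subset (nV Γ)
    Es     : Subset (nE Γ)
    closed : ∀ e → e ∈ Es → (src Γ e ∈ Vs) × (tgt Γ e ∈ Vs)
open Subgraph public

whole : (Γ : Graph) → Subgraph Γ
whole Γ = record { Vs = ⊤ ; Es = ⊤ ; closed = λ e _ → ∈⊤ , ∈⊤ }
  where open import Data.Fin.Subset.Properties using (∈⊤)

data Reach (Γ : Graph) (P : Fin (nE Γ) → Set) : Fin (nV Γ) → Fin (nV Γ) → Set where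
  here : ∀ {u} → Reach Γ P u u
  fwd  : ∀ {u} e → P e → Reach Γ P (tgt Γ e) u → Reach Γ P (src Γ e) u
  bwd  : ∀ {u} e → P e → Reach Γ P (src Γ e) u → Reach Γ P (tgt Γ e) u

ConnectedSub : {Γ : Graph} → Subgraph Γ → Set
ConnectedSub {Γ} G = ∀ u w → u ∈ Vs G → w ∈ Vs G → Reach Γ (λ e → e ∈ Es G) u w

Connected : Graph → Set
Connected Γ = ConnectedSub (whole Γ)

IsArticulation : (Γ : Graph) → Fin (nV Γ) → Set
IsArticulation Γ v0 =
  ∃[ u ] ∃[ w ] (u ≢ v0 × w ≢ v0 ×
    ¬ Reach Γ (λ e → (src Γ e ≢ v0) × (tgt Γ e ≢ v0)) u w)

record IsSplit (Γ : Graph) (v0 : Fin (nV Γ)) (G₁ G₂ : Subgraph Γ) : Set where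
  field
    conn₁   : ConnectedSub G₁
    conn₂   : ConnectedSub G₂
    edge₁   : Nonempty (Es G₁)
    edge₂   : Nonempty (Es G₂)
    Vcap    : Vs G₁ ∩ Vs G₂ ≡ ⁅ v0 ⁆
    Vcup    : Vs G₁ ∪ Vs G₂ ≡ ⊤
    Ecap    : ∀ e → e ∈ Es G₁ → e ∉ Es G₂
    Ecup    : Es G₁ ∪ Es G₂ ≡ ⊤

-- A pseudo-divisor (ℰ , D) on (a subgraph G of) Γ is
-- recorded as ℰ ⊆ E(Γ) together with the values of D on the ordinary
-- vertices V(Γ) (extension by zero outside V(G)); the value on each
-- exceptional vertex v_e (e ∈ ℰ) is 1 by definition and is not stored.

record PseudoDivisor (Γ : Graph) : Set where
  constructor ⟨_,_⟩
  field
    exc : Subset (nE Γ)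
    div : Fin (nV Γ) → ℤ
open PseudoDivisor public

module _ {Γ : Graph} where

  _≈PD_ : PseudoDivisor Γ → PseudoDivisor Γ → Set
  ⟨ ℰ , D ⟩ ≈PD ⟨ ℰ' , D' ⟩ = (ℰ ≡ ℰ') × (∀ v → D v ≡ D' v)

  -- valence in G (loops count twice)
  val : Subgraph Γ → Fin (nV Γ) → ℕ
  val G v = Σℕ (λ e → if e ∈ᵇ Es G
                        then [ src Γ e == v ] ℕ.+ [ tgt Γ e == v ] else 0)

  genus : Subgraph Γ → ℤ
  genus G = (+ ∣ Es G ∣ - + ∣ Vs G ∣) + 1ℤ

  degree : Subgraph Γ → PseudoDivisor Γ → ℤ
  degree G ⟨ ℰ , D ⟩ = Σℤ (λ v → if v ∈ᵇ Vs G then D v else 0ℤ) + + ∣ ℰ ∣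

  -- A subset V of V(G^ℰ) is a pair (S , T): S ⊆ V(G) ordinary vertices,
  -- T ⊆ ℰ the exceptional vertices v_e (e ∈ T).
  -- δ_V: number of edges of G^ℰ between V and its complement.
  -- An edge e ∈ E(G) ∖ ℰ joins src e and tgt e; an edge e ∈ ℰ is
  -- replaced by the two edges src e — v_e and v_e — tgt e.
  δ : Subgraph Γ → Subset (nE Γ) → Subset (nV Γ) → Subset (nE Γ) → ℕ
  δ G ℰ S T = Σℕ (λ e →
    if e ∈ᵇ Es G
    then (if e ∈ᵇ ℰ
          then [ (src Γ e ∈ᵇ S) xor (e ∈ᵇ T) ] ℕ.+ [ (tgt Γ e ∈ᵇ S) xor (e ∈ᵇ T) ]
          else [ (src Γ e ∈ᵇ S) xor (tgt Γ e ∈ᵇ S) ])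
    else 0)

  -- 2 · ( D(V) − μ(V) + δ_V / 2 ), where μ(v) = −1 + val_G(v)/2 on
  -- ordinary vertices and 0 on exceptional ones; multiplied by 2 to stay
  -- in ℤ (sign unchanged).
  twiceSlack : Subgraph Γ → PseudoDivisor Γ → Subset (nV Γ) → Subset (nE Γ) → ℤ
  twiceSlack G ⟨ ℰ , D ⟩ S T =
      (+ 2) * (Σℤ (λ v → if v ∈ᵇ S then D v else 0ℤ) + + ∣ T ∣)
    - Σℤ (λ v → if v ∈ᵇ S then (+ val G v - + 2) else 0ℤ)
    + + δ G ℰ S T

  record IsQD (G : Subgraph Γ) (v0 : Fin (nV Γ)) (x : PseudoDivisor Γ) : Set where
    field
      edges⊆   : exc x ⊆ Es G
      support  : ∀ v → v ∉ Vs G → div x v ≡ 0ℤ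
      deg      : degree G x ≡ genus G - 1ℤ
      stable   : ∀ (S : Subset (nV Γ)) (T : Subset (nE Γ)) →
                   S ⊆ Vs G → T ⊆ exc x →
                   (Nonempty S ⊎ Nonempty T) →
                   0ℤ ≤ twiceSlack G x S T
      strict   : ∀ (S : Subset (nV Γ)) (T : Subset (nE Γ)) →
                   S ⊆ Vs G → T ⊆ exc x →
                   (Nonempty S ⊎ Nonempty T) → v0 ∉ S →
                   0ℤ < twiceSlack G x S T

  -- The order:  (ℰ' , D') ≤ (ℰ , D) in the poset of pseudo-divisors of G
  -- iff ℰ' ⊆ ℰ and there is φ assigning to each e ∈ ℰ ∖ ℰ' an end-vertex
  -- with D'(v) = D(v) + |φ⁻¹(v)| for v ∈ V(G).  (φ is given as a total
  -- function on edges; only its values on ℰ ∖ ℰ' matter.)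
  PDLeq : Subgraph Γ → PseudoDivisor Γ → PseudoDivisor Γ → Set
  PDLeq G ⟨ ℰ' , D' ⟩ ⟨ ℰ , D ⟩ =
    (ℰ' ⊆ ℰ) ×
    Σ (Fin (nE Γ) → Fin (nV Γ)) λ φ → ((∀ e → e ∈ ℰ → e ∉ ℰ' → (φ e ≡ src Γ e) ⊎ (φ e ≡ tgt Γ e)) ×
            (∀ v → v ∈ Vs G →
               D' v ≡ D v + + Σℕ (λ e → [ (e ∈ᵇ ℰ) ∧ not (e ∈ᵇ ℰ') ∧ (φ e == v) ])))

σ : (Γ : Graph) → Fin (nV Γ) → PseudoDivisor Γ → PseudoDivisor Γ → PseudoDivisor Γ
σ Γ v0 ⟨ ℰ₁ , D₁ ⟩ ⟨ ℰ₂ , D₂ ⟩ =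
  ⟨ ℰ₁ ∪ ℰ₂ , (λ v → D₁ v + D₂ v + [ v == v0 ]ℤ) ⟩
  where
    [_]ℤ : Bool → ℤ
    [ b ]ℤ = + [ b ]

{-# OPTIONS --safe #-}
module Submission where

-- Over a split, everything in the quasistability condition is additive.  A test set (S , T) for Γ^ℰ
-- meets G₁ and G₂ in test sets (S ∩ V₁ , T ∩ E₁) and (S ∩ V₂ , T ∩ E₂); divisor values, subdivided
-- edges and crossing edges are counted once, on the side of their edge, and only v0 is counted on both
-- sides, in μ and in the degree: the extra point v0 added by σ compensates exactly.  So the slack of
-- σ(x₁ , x₂) at (S , T) is the sum of the slacks of x₁ and x₂ at the two halves, and deg σ(x₁ , x₂) =
-- (g₁ − 1) + (g₂ − 1) + 1 = g − 1; hence σ lands in QD_{v0}(Γ).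
-- Conversely, (ℰ , D) ∈ QD_{v0}(Γ) is cut into its restrictions to G₁ and G₂, D(v0) being shared so
-- that the first piece has degree g₁ − 1.  A test set (S , T) of G₁ with v0 ∉ S sees nothing of G₂;
-- if v0 ∈ S, test (ℰ , D) on (S ∪ V₂ , T ∪ ℰ₂) instead, where G₂ contributes its total slack, which is 0.
-- A witness φ for the order splits along the partition of the edges; it compares the divisors on each
-- side away from v0, and at v0 the comparison is forced by the equality of degrees.  Injectivity is
-- then antisymmetry of ≤, and the last statement is the order reflection applied to σ⁻¹(ℰ ∖ {e} , D̄).

open import Defs
open import Data.Bool using (Bool; true; false; _∧_; _∨_; not; _xor_; if_then_else_)
open import Data.Bool.Properties using (∨-comm; ∧-comm; not-involutive; ∧-zeroʳ; ∧-identityʳ; ∨-identityʳ)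
open import Data.Nat as ℕ using (ℕ; zero; suc)
open import Data.Integer using (ℤ; +_; 0ℤ; 1ℤ; _+_; _-_; _*_; _≤_; _<_; -_)
import Data.Integer.Properties as ℤP
open import Algebra.Properties.AbelianGroup ℤP.+-0-abelianGroup using () renaming (∙-cancelʳ to +-cancelʳ)
import Data.Nat.Properties as ℕP
open import Data.Integer.Tactic.RingSolver using (solve-∀)
import Data.Nat.Tactic.RingSolver as ℕRing
open import Data.Vec using ([]; _∷_; lookup)
open import Data.Vec.Properties using ([]=⇒lookup; lookup⇒[]=; lookup-zipWith)
open import Data.Fin using (Fin; zero; suc; _≟_)
open import Data.Fin.Subset using (Subset; _∈_; _∉_; _⊆_; _∪_; _∩_; _─_; ⁅_⁆; ⊤; ⊥; ∣_∣; Nonempty)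
open import Data.Fin.Subset.Properties
  using (_∈?_; nonempty?; Empty-unique; ∈⊤; ∉⊥; x∈⁅x⁆; x∈⁅y⁆⇒x≡y; ∣⊥∣≡0; ∣⁅x⁆∣≡1; ⊆-antisym; ⊆-min;
         p∩q⊆p; p∩q⊆q; x∈p∩q⁺; x∈p∩q⁻; p⊆p∪q; q⊆p∪q; x∈p∪q⁻; p─q⊆p; x∈p∧x∉q⇒x∈p─q;
         ∩-identityˡ; ∩-distribʳ-∪; ∪-identityˡ; ∪-identityʳ)
open import Data.Product using (Σ; _×_; _,_; proj₁; proj₂; ∃-syntax; uncurry)
open import Function using (_∘_; _$_; id)
open import Function.Bundles using (_⇔_; mk⇔)
open import Data.Sum using (_⊎_; inj₁; inj₂; [_,_]′)
open import Relation.Binary.PropositionalEquality hiding ([_])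
open import Relation.Nullary using (Dec; yes; no; ¬_; contradiction)
open import Relation.Nullary.Decidable using (⌊_⌋; dec-true; dec-false; isYes≗does)

⌊⌋-true : ∀ {a} {A : Set a} (a? : Dec A) → A → ⌊ a? ⌋ ≡ true
⌊⌋-true a? a = trans (isYes≗does a?) (dec-true a? a)

⌊⌋-false : ∀ {a} {A : Set a} (a? : Dec A) → ¬ A → ⌊ a? ⌋ ≡ false
⌊⌋-false a? ¬a = trans (isYes≗does a?) (dec-false a? ¬a)

true≢false : true ≢ false
true≢false ()

cong₃ : ∀ {A B C D : Set} (f : A → B → C → D) {a a' b b' c c'} →
        a ≡ a' → b ≡ b' → c ≡ c' → f a b c ≡ f a' b' c'
cong₃ f refl refl refl = refl

∧-trueˡ : ∀ {a b} → (a ∧ b) ≡ true → a ≡ true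
∧-trueˡ {true} _ = refl

∧-trueʳ : ∀ {a b} → (a ∧ b) ≡ true → b ≡ true
∧-trueʳ {true} h = h

module _ {n : ℕ} where

  ∈⇒∈ᵇ : {x : Fin n} {p : Subset n} → x ∈ p → x ∈ᵇ p ≡ true
  ∈⇒∈ᵇ {x} {p} = ⌊⌋-true (x ∈? p)

  ∉⇒∈ᵇ : {x : Fin n} {p : Subset n} → x ∉ p → x ∈ᵇ p ≡ false
  ∉⇒∈ᵇ {x} {p} = ⌊⌋-false (x ∈? p)

  ∈ᵇ≡lookup : (x : Fin n) (p : Subset n) → x ∈ᵇ p ≡ lookup p x
  ∈ᵇ≡lookup x p with lookup p x in eq
  ... | true  = ∈⇒∈ᵇ (lookup⇒[]= x p eq)
  ... | false = ∉⇒∈ᵇ (λ x∈p → true≢false (trans (sym ([]=⇒lookup x∈p)) eq))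

  ∈ᵇ⇒∈ : {x : Fin n} {p : Subset n} → x ∈ᵇ p ≡ true → x ∈ p
  ∈ᵇ⇒∈ {x} {p} h = lookup⇒[]= x p (trans (sym (∈ᵇ≡lookup x p)) h)

  ∈ᵇ⇒∉ : {x : Fin n} {p : Subset n} → x ∈ᵇ p ≡ false → x ∉ p
  ∈ᵇ⇒∉ h x∈p = true≢false (trans (sym (∈⇒∈ᵇ x∈p)) h)

  ∈ᵇ-∩ : (x : Fin n) (p q : Subset n) → x ∈ᵇ (p ∩ q) ≡ (x ∈ᵇ p ∧ x ∈ᵇ q)
  ∈ᵇ-∩ x p q rewrite ∈ᵇ≡lookup x (p ∩ q) | ∈ᵇ≡lookup x p | ∈ᵇ≡lookup x q = lookup-zipWith _∧_ x p q

  ∈ᵇ-∪ : (x : Fin n) (p q : Subset n) → x ∈ᵇ (p ∪ q) ≡ (x ∈ᵇ p ∨ x ∈ᵇ q)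
  ∈ᵇ-∪ x p q rewrite ∈ᵇ≡lookup x (p ∪ q) | ∈ᵇ≡lookup x p | ∈ᵇ≡lookup x q = lookup-zipWith _∨_ x p q

  ∈ᵇ-─ : (x : Fin n) (p q : Subset n) → x ∈ᵇ (p ─ q) ≡ (x ∈ᵇ p ∧ not (x ∈ᵇ q))
  ∈ᵇ-─ x p q rewrite ∈ᵇ≡lookup x (p ─ q) | ∈ᵇ≡lookup x p | ∈ᵇ≡lookup x q = lookup-─ p q x
    where
    lookup-─ : ∀ {k} (p q : Subset k) x → lookup (p ─ q) x ≡ (lookup p x ∧ not (lookup q x))
    lookup-─ (a ∷ p) (true ∷ q)  zero    = sym (∧-zeroʳ a)
    lookup-─ (a ∷ p) (false ∷ q) zero    = sym (∧-identityʳ a)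
    lookup-─ (_ ∷ p) (_ ∷ q)     (suc x) = lookup-─ p q x

  ∈ᵇ-⊤ : (x : Fin n) → x ∈ᵇ ⊤ ≡ true
  ∈ᵇ-⊤ x = ∈⇒∈ᵇ ∈⊤

  ∈ᵇ-⊥ : (x : Fin n) → x ∈ᵇ ⊥ ≡ false
  ∈ᵇ-⊥ x = ∉⇒∈ᵇ ∉⊥

  ==-refl : (x : Fin n) → (x == x) ≡ true
  ==-refl x = ⌊⌋-true (x ≟ x) refl

  ≢⇒== : {x y : Fin n} → x ≢ y → (x == y) ≡ false
  ≢⇒== {x} {y} = ⌊⌋-false (x ≟ y)

  ∈ᵇ-⁅⁆ : (x a : Fin n) → x ∈ᵇ ⁅ a ⁆ ≡ (x == a)
  ∈ᵇ-⁅⁆ x a with x ≟ a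
  ... | yes refl = ∈⇒∈ᵇ (x∈⁅x⁆ x)
  ... | no x≢a   = ∉⇒∈ᵇ (x≢a ∘ x∈⁅y⁆⇒x≡y a)

  ∈ᵇ-ext : {p q : Subset n} → (∀ x → x ∈ᵇ p ≡ x ∈ᵇ q) → p ≡ q
  ∈ᵇ-ext h = ⊆-antisym (λ x∈p → ∈ᵇ⇒∈ (trans (sym (h _)) (∈⇒∈ᵇ x∈p)))
                        (λ x∈q → ∈ᵇ⇒∈ (trans (h _) (∈⇒∈ᵇ x∈q)))

==-suc : ∀ {n} (x y : Fin n) → (suc x == suc y) ≡ (x == y)
==-suc x y with x ≟ y
... | yes _ = refl
... | no _  = refl

module _ {n : ℕ} {p q : Subset n} where

  ⊆⇒∩≡ : p ⊆ q → p ∩ q ≡ p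
  ⊆⇒∩≡ p⊆q = ⊆-antisym (p∩q⊆p p q) (λ x∈p → x∈p∩q⁺ (x∈p , p⊆q x∈p))

  ⊇⇒∩≡ : q ⊆ p → p ∩ q ≡ q
  ⊇⇒∩≡ q⊆p = ⊆-antisym (p∩q⊆q p q) (λ x∈q → x∈p∩q⁺ (q⊆p x∈q , x∈q))

  ⊇⇒∪≡ : q ⊆ p → p ∪ q ≡ p
  ⊇⇒∪≡ q⊆p = ⊆-antisym (λ x∈p∪q → [ id , q⊆p ]′ (x∈p∪q⁻ p q x∈p∪q)) (p⊆p∪q q)

  disjoint⇒∩≡⊥ : (∀ {x} → x ∈ p → x ∉ q) → p ∩ q ≡ ⊥
  disjoint⇒∩≡⊥ disjoint =
    ⊆-antisym (λ x∈p∩q → let (x∈p , x∈q) = x∈p∩q⁻ p q x∈p∩q in contradiction x∈q (disjoint x∈p)) (⊆-min _)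

module _ {n : ℕ} (p q r : Subset n) where

  ─-∩-comm : (p ─ q) ∩ r ≡ (p ∩ r) ─ q
  ─-∩-comm = ∈ᵇ-ext λ i → begin
    i ∈ᵇ ((p ─ q) ∩ r)                  ≡⟨ trans (∈ᵇ-∩ i (p ─ q) r) (cong (_∧ i ∈ᵇ r) (∈ᵇ-─ i p q)) ⟩
    (i ∈ᵇ p ∧ not (i ∈ᵇ q)) ∧ i ∈ᵇ r    ≡⟨ swap-last (i ∈ᵇ p) (not (i ∈ᵇ q)) (i ∈ᵇ r) ⟩
    (i ∈ᵇ p ∧ i ∈ᵇ r) ∧ not (i ∈ᵇ q)    ≡⟨ sym (trans (∈ᵇ-─ i (p ∩ r) q) (cong (_∧ not (i ∈ᵇ q)) (∈ᵇ-∩ i p r))) ⟩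
    i ∈ᵇ ((p ∩ r) ─ q)                  ∎
    where
    open ≡-Reasoning
    swap-last : ∀ a b c → (a ∧ b) ∧ c ≡ (a ∧ c) ∧ b
    swap-last true  b c = ∧-comm b c
    swap-last false b c = refl

  ─-∩-disjoint : (∀ {i} → i ∈ r → i ∉ q) → (p ─ q) ∩ r ≡ p ∩ r
  ─-∩-disjoint disjoint = trans ─-∩-comm (⊆-antisym (p─q⊆p (p ∩ r) q)
    (λ i∈p∩r → x∈p∧x∉q⇒x∈p─q i∈p∩r (disjoint (p∩q⊆q p r i∈p∩r))))

if-same : ∀ {A : Set} (b : Bool) (x : A) → (if b then x else x) ≡ x
if-same true  x = refl
if-same false x = refl

Σℕ-cong : ∀ {k} {f g : Fin k → ℕ} → (∀ i → f i ≡ g i) → Σℕ f ≡ Σℕ g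
Σℕ-cong {zero}  h = refl
Σℕ-cong {suc k} h = cong₂ ℕ._+_ (h zero) (Σℕ-cong (h ∘ suc))

Σℕ-zero : ∀ {k} {f : Fin k → ℕ} → (∀ i → f i ≡ 0) → Σℕ f ≡ 0
Σℕ-zero {zero}  h = refl
Σℕ-zero {suc k} h rewrite h zero = Σℕ-zero (h ∘ suc)

Σℕ-+ : ∀ {k} (f g : Fin k → ℕ) → Σℕ (λ i → f i ℕ.+ g i) ≡ Σℕ f ℕ.+ Σℕ g
Σℕ-+ {zero}  f g = refl
Σℕ-+ {suc k} f g rewrite Σℕ-+ (f ∘ suc) (g ∘ suc) =
  interchange (f zero) (g zero) (Σℕ (f ∘ suc)) (Σℕ (g ∘ suc))
  where
  interchange : ∀ a b c d → a ℕ.+ b ℕ.+ (c ℕ.+ d) ≡ a ℕ.+ c ℕ.+ (b ℕ.+ d)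
  interchange = ℕRing.solve-∀

Σℕ-swap : ∀ {k m} (f : Fin k → Fin m → ℕ) → Σℕ (λ i → Σℕ (f i)) ≡ Σℕ (λ j → Σℕ (λ i → f i j))
Σℕ-swap {zero}  {m} f = sym (Σℕ-zero {m} (λ _ → refl))
Σℕ-swap {suc k} {m} f rewrite Σℕ-swap (f ∘ suc) = sym (Σℕ-+ (f zero) (λ j → Σℕ (λ i → f (suc i) j)))

if-Σℕ : ∀ {k} (b : Bool) (f : Fin k → ℕ) → (if b then Σℕ f else 0) ≡ Σℕ (λ i → if b then f i else 0)
if-Σℕ true  f = refl
if-Σℕ {k} false f = sym (Σℕ-zero {k} (λ _ → refl))

Σℕ-point : ∀ {k} (a : Fin k) (c : ℕ) → Σℕ (λ v → if v == a then c else 0) ≡ c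
Σℕ-point {suc k} zero    c = trans (cong (c ℕ.+_) (Σℕ-zero {k} (λ _ → refl))) (ℕP.+-identityʳ c)
Σℕ-point {suc k} (suc a) c =
  trans (Σℕ-cong (λ i → cong (λ b → if b then c else 0) (==-suc i a))) (Σℕ-point a c)

Σℕ-δ : ∀ {k} (V : Subset k) (a : Fin k) → Σℕ (λ v → if v ∈ᵇ V then [ a == v ] else 0) ≡ [ a ∈ᵇ V ]
Σℕ-δ V a = trans (Σℕ-cong reshape) (Σℕ-point a [ a ∈ᵇ V ])
  where
  reshape : ∀ v → (if v ∈ᵇ V then [ a == v ] else 0) ≡ (if v == a then [ a ∈ᵇ V ] else 0)
  reshape v with v ≟ a
  ... | yes refl rewrite ==-refl v = refl
  ... | no v≢a rewrite ≢⇒== (v≢a ∘ sym) = if-same (v ∈ᵇ V) 0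

Σℤ-cong : ∀ {k} {f g : Fin k → ℤ} → (∀ i → f i ≡ g i) → Σℤ f ≡ Σℤ g
Σℤ-cong {zero}  h = refl
Σℤ-cong {suc k} h = cong₂ _+_ (h zero) (Σℤ-cong (h ∘ suc))

Σℤ-zero : ∀ {k} {f : Fin k → ℤ} → (∀ i → f i ≡ 0ℤ) → Σℤ f ≡ 0ℤ
Σℤ-zero {zero}  h = refl
Σℤ-zero {suc k} h rewrite h zero = trans (ℤP.+-identityˡ _) (Σℤ-zero (h ∘ suc))

Σℤ-+ : ∀ {k} (f g : Fin k → ℤ) → Σℤ (λ i → f i + g i) ≡ Σℤ f + Σℤ g
Σℤ-+ {zero}  f g = refl
Σℤ-+ {suc k} f g rewrite Σℤ-+ (f ∘ suc) (g ∘ suc) =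
  interchange (f zero) (g zero) (Σℤ (f ∘ suc)) (Σℤ (g ∘ suc))
  where
  interchange : ∀ a b c d → a + b + (c + d) ≡ a + c + (b + d)
  interchange = solve-∀

Σℤ-- : ∀ {k} (f g : Fin k → ℤ) → Σℤ (λ i → f i - g i) ≡ Σℤ f - Σℤ g
Σℤ-- f g = trans (Σℤ-+ f (λ i → - g i)) (cong (λ z → Σℤ f + z) (Σℤ-neg g))
  where
  Σℤ-neg : ∀ {k} (f : Fin k → ℤ) → Σℤ (λ i → - f i) ≡ - Σℤ f
  Σℤ-neg {zero}  f = refl
  Σℤ-neg {suc k} f rewrite Σℤ-neg (f ∘ suc) = sym (ℤP.neg-distrib-+ (f zero) _)

Σℤ-point : ∀ {k} (a : Fin k) (c : ℤ) → Σℤ (λ v → if v == a then c else 0ℤ) ≡ c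
Σℤ-point {suc k} zero    c = trans (cong (λ z → c + z) (Σℤ-zero {k} (λ _ → refl))) (ℤP.+-identityʳ c)
Σℤ-point {suc k} (suc a) c = trans (ℤP.+-identityˡ _)
  (trans (Σℤ-cong (λ i → cong (λ b → if b then c else 0ℤ) (==-suc i a))) (Σℤ-point a c))

Σℤ-pos : ∀ {k} (f : Fin k → ℕ) → Σℤ (λ i → + f i) ≡ + Σℕ f
Σℤ-pos {zero}  f = refl
Σℤ-pos {suc k} f rewrite Σℤ-pos (f ∘ suc) = sym (ℤP.pos-+ (f zero) _)

∣∣≡Σℕ : ∀ {n} (p : Subset n) → ∣ p ∣ ≡ Σℕ (λ i → [ i ∈ᵇ p ])
∣∣≡Σℕ p = trans (count p) (Σℕ-cong (λ i → cong [_] (sym (∈ᵇ≡lookup i p))))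
  where
  count : ∀ {k} (p : Subset k) → ∣ p ∣ ≡ Σℕ (λ i → [ lookup p i ])
  count []          = refl
  count (true ∷ p)  = cong suc (count p)
  count (false ∷ p) = count p

∣∣+∣∣-cong : ∀ {n} {p q r s : Subset n} → (∀ i → [ i ∈ᵇ p ] ℕ.+ [ i ∈ᵇ q ] ≡ [ i ∈ᵇ r ] ℕ.+ [ i ∈ᵇ s ]) →
             ∣ p ∣ ℕ.+ ∣ q ∣ ≡ ∣ r ∣ ℕ.+ ∣ s ∣
∣∣+∣∣-cong {n} {p} {q} {r} {s} h rewrite ∣∣≡Σℕ p | ∣∣≡Σℕ q | ∣∣≡Σℕ r | ∣∣≡Σℕ s =
  trans (sym (Σℕ-+ {n} _ _)) (trans (Σℕ-cong h) (Σℕ-+ {n} _ _))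

∣─∣+∣∣ : ∀ {n} {p q : Subset n} → q ⊆ p → ∣ p ─ q ∣ ℕ.+ ∣ q ∣ ≡ ∣ p ∣
∣─∣+∣∣ {n} {p} {q} q⊆p =
  trans (∣∣+∣∣-cong per-element) (trans (cong (∣ p ∣ ℕ.+_) (∣⊥∣≡0 n)) (ℕP.+-identityʳ _))
  where
  per-element : ∀ i → [ i ∈ᵇ (p ─ q) ] ℕ.+ [ i ∈ᵇ q ] ≡ [ i ∈ᵇ p ] ℕ.+ [ i ∈ᵇ ⊥ ]
  per-element i rewrite ∈ᵇ-─ i p q | ∈ᵇ-⊥ i with i ∈ᵇ p in i∈p | i ∈ᵇ q in i∈q
  ... | true  | true  = refl
  ... | true  | false = refl
  ... | false | false = refl
  ... | false | true  = contradiction (trans (sym (∈⇒∈ᵇ (q⊆p (∈ᵇ⇒∈ i∈q)))) i∈p) true≢false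

ΣℤOn : ∀ {k} → Subset k → (Fin k → ℤ) → ℤ
ΣℤOn S f = Σℤ (λ v → if v ∈ᵇ S then f v else 0ℤ)

ΣℤOn-+ : ∀ {k} (S : Subset k) (f g : Fin k → ℤ) → ΣℤOn S (λ v → f v + g v) ≡ ΣℤOn S f + ΣℤOn S g
ΣℤOn-+ {k} S f g = trans (Σℤ-cong distrib) (Σℤ-+ {k} _ _)
  where
  distrib : ∀ v → (if v ∈ᵇ S then f v + g v else 0ℤ) ≡
                  (if v ∈ᵇ S then f v else 0ℤ) + (if v ∈ᵇ S then g v else 0ℤ)
  distrib v with v ∈ᵇ S
  ... | true  = refl
  ... | false = refl

ΣℤOn-∩-split : ∀ {k} (S Va Vb : Subset k) (f fa fb c : Fin k → ℤ) →
  (∀ v → v ∈ᵇ S ≡ true → f v ≡ (if v ∈ᵇ Va then fa v else 0ℤ) + (if v ∈ᵇ Vb then fb v else 0ℤ) + c v) →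
  ΣℤOn S f ≡ ΣℤOn (S ∩ Va) fa + ΣℤOn (S ∩ Vb) fb + ΣℤOn S c
ΣℤOn-∩-split {k} S Va Vb f fa fb c h =
  trans (Σℤ-cong pointwise) (trans (Σℤ-+ {k} _ _) (cong (_+ ΣℤOn S c) (Σℤ-+ {k} _ _)))
  where
  pointwise : ∀ v → (if v ∈ᵇ S then f v else 0ℤ) ≡
    (if v ∈ᵇ (S ∩ Va) then fa v else 0ℤ) + (if v ∈ᵇ (S ∩ Vb) then fb v else 0ℤ) + (if v ∈ᵇ S then c v else 0ℤ)
  pointwise v rewrite ∈ᵇ-∩ v S Va | ∈ᵇ-∩ v S Vb with v ∈ᵇ S in v∈S
  ... | true  = h v v∈S
  ... | false = refl

ΣℤOn-determines : ∀ {k} {V : Subset k} {a : Fin k} {f g : Fin k → ℤ} → a ∈ᵇ V ≡ true →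
  (∀ {v} → v ∈ᵇ V ≡ true → v ≢ a → f v ≡ g v) → ΣℤOn V f ≡ ΣℤOn V g → f a ≡ g a
ΣℤOn-determines {k} {V} {a} {f} {g} a∈V agree ΣfV≡ΣgV = ℤP.i-j≡0⇒i≡j (f a) (g a) $
  begin
    f a - g a
  ≡⟨ sym (Σℤ-point a (f a - g a)) ⟩
    Σℤ (λ v → if v == a then f a - g a else 0ℤ)
  ≡⟨ sym (Σℤ-cong difference) ⟩
    Σℤ (λ v → (if v ∈ᵇ V then f v else 0ℤ) - (if v ∈ᵇ V then g v else 0ℤ))
  ≡⟨ Σℤ-- {k} _ _ ⟩
    ΣℤOn V f - ΣℤOn V g
  ≡⟨ ℤP.i≡j⇒i-j≡0 ΣfV≡ΣgV ⟩
    0ℤ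
  ∎
  where
  open ≡-Reasoning
  difference : ∀ v → (if v ∈ᵇ V then f v else 0ℤ) - (if v ∈ᵇ V then g v else 0ℤ) ≡
                     (if v == a then f a - g a else 0ℤ)
  difference v with v ≟ a
  ... | yes refl rewrite a∈V = refl
  ... | no v≢a with v ∈ᵇ V in v∈V
  ...   | true  = ℤP.i≡j⇒i-j≡0 (agree v∈V v≢a)
  ...   | false = refl

∈ᵇ-distinct : ∀ {n} {V : Subset n} {a b : Fin n} → a ∈ᵇ V ≡ true → b ∈ᵇ V ≡ false → (a == b) ≡ false
∈ᵇ-distinct a∈V b∉V = ≢⇒== (λ { refl → true≢false (trans (sym a∈V) b∉V) })

endpoints∈ᵇ : ∀ {Γ} (G : Subgraph Γ) {e} → e ∈ᵇ Es G ≡ true →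
              (src Γ e ∈ᵇ Vs G ≡ true) × (tgt Γ e ∈ᵇ Vs G ≡ true)
endpoints∈ᵇ G {e} e∈G = let (s , t) = closed G e (∈ᵇ⇒∈ e∈G) in ∈⇒∈ᵇ s , ∈⇒∈ᵇ t

endpoint∈ᵇ : ∀ {Γ} (G : Subgraph Γ) {e} {u : Fin (nV Γ)} → e ∈ᵇ Es G ≡ true →
             (u ≡ src Γ e) ⊎ (u ≡ tgt Γ e) → u ∈ᵇ Vs G ≡ true
endpoint∈ᵇ G e∈G (inj₁ refl) = proj₁ (endpoints∈ᵇ G e∈G)
endpoint∈ᵇ G e∈G (inj₂ refl) = proj₂ (endpoints∈ᵇ G e∈G)

val-outside : ∀ {Γ} (G : Subgraph Γ) {v} → v ∈ᵇ Vs G ≡ false → val G v ≡ 0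
val-outside {Γ} G {v} v∉G = Σℕ-zero incident
  where
  incident : ∀ e → (if e ∈ᵇ Es G then [ src Γ e == v ] ℕ.+ [ tgt Γ e == v ] else 0) ≡ 0
  incident e with e ∈ᵇ Es G in e∈G
  ... | false = refl
  ... | true rewrite ∈ᵇ-distinct (proj₁ (endpoints∈ᵇ G e∈G)) v∉G
                   | ∈ᵇ-distinct (proj₂ (endpoints∈ᵇ G e∈G)) v∉G = refl

handshake : ∀ {Γ} (G : Subgraph Γ) →
            Σℕ (λ v → if v ∈ᵇ Vs G then val G v else 0) ≡ ∣ Es G ∣ ℕ.+ ∣ Es G ∣
handshake {Γ} G =
  begin
    Σℕ (λ v → if v ∈ᵇ Vs G then val G v else 0)
  ≡⟨ Σℕ-cong (λ v → if-Σℕ (v ∈ᵇ Vs G) (incidences v)) ⟩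
    Σℕ (λ v → Σℕ (λ e → if v ∈ᵇ Vs G then incidences v e else 0))
  ≡⟨ Σℕ-swap (λ v e → if v ∈ᵇ Vs G then incidences v e else 0) ⟩
    Σℕ (λ e → Σℕ (λ v → if v ∈ᵇ Vs G then incidences v e else 0))
  ≡⟨ Σℕ-cong two-ends ⟩
    Σℕ (λ e → [ e ∈ᵇ Es G ] ℕ.+ [ e ∈ᵇ Es G ])
  ≡⟨ trans (Σℕ-+ {nE Γ} _ _) (sym (cong₂ ℕ._+_ (∣∣≡Σℕ (Es G)) (∣∣≡Σℕ (Es G)))) ⟩
    ∣ Es G ∣ ℕ.+ ∣ Es G ∣
  ∎
  where
  open ≡-Reasoning
  incidences : Fin (nV Γ) → Fin (nE Γ) → ℕ
  incidences v e = if e ∈ᵇ Es G then [ src Γ e == v ] ℕ.+ [ tgt Γ e == v ] else 0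
  two-ends : ∀ e → Σℕ (λ v → if v ∈ᵇ Vs G then incidences v e else 0) ≡ [ e ∈ᵇ Es G ] ℕ.+ [ e ∈ᵇ Es G ]
  two-ends e with e ∈ᵇ Es G in e∈G
  ... | false = Σℕ-zero {nV Γ} (λ v → if-same (v ∈ᵇ Vs G) 0)
  ... | true  = trans (Σℕ-cong split-ends) (trans (Σℕ-+ {nV Γ} _ _)
                  (cong₂ ℕ._+_ (trans (Σℕ-δ (Vs G) (src Γ e)) (cong [_] (proj₁ (endpoints∈ᵇ G e∈G))))
                               (trans (Σℕ-δ (Vs G) (tgt Γ e)) (cong [_] (proj₂ (endpoints∈ᵇ G e∈G))))))
    where
    split-ends : ∀ v → (if v ∈ᵇ Vs G then [ src Γ e == v ] ℕ.+ [ tgt Γ e == v ] else 0) ≡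
                       (if v ∈ᵇ Vs G then [ src Γ e == v ] else 0) ℕ.+ (if v ∈ᵇ Vs G then [ tgt Γ e == v ] else 0)
    split-ends v with v ∈ᵇ Vs G
    ... | true  = refl
    ... | false = refl

twiceμ : ∀ {Γ} → Subgraph Γ → Subset (nV Γ) → ℤ
twiceμ G S = ΣℤOn S (λ v → + val G v - + 2)

record SplitData (Γ : Graph) (v0 : Fin (nV Γ)) (G₁ G₂ : Subgraph Γ) : Set where
  field
    V-cover : ∀ v → (v ∈ᵇ Vs G₁ ∨ v ∈ᵇ Vs G₂) ≡ true
    V-meet  : ∀ v → (v ∈ᵇ Vs G₁ ∧ v ∈ᵇ Vs G₂) ≡ (v == v0)
    E-compl : ∀ e → e ∈ᵇ Es G₂ ≡ not (e ∈ᵇ Es G₁)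

splitData : ∀ {Γ v0 G₁ G₂} → IsSplit Γ v0 G₁ G₂ → SplitData Γ v0 G₁ G₂
splitData {Γ} {v0} {G₁} {G₂} split = record
  { V-cover = λ v → trans (sym (∈ᵇ-∪ v (Vs G₁) (Vs G₂))) (trans (cong (v ∈ᵇ_) Vcup) (∈ᵇ-⊤ v))
  ; V-meet  = λ v → trans (sym (∈ᵇ-∩ v (Vs G₁) (Vs G₂))) (trans (cong (v ∈ᵇ_) Vcap) (∈ᵇ-⁅⁆ v v0))
  ; E-compl = λ e → complement (trans (sym (∈ᵇ-∪ e (Es G₁) (Es G₂))) (trans (cong (e ∈ᵇ_) Ecup) (∈ᵇ-⊤ e)))
                               (∉⇒∈ᵇ ∘ Ecap e ∘ ∈ᵇ⇒∈)
  }
  where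
  open IsSplit split
  complement : ∀ {a b} → (a ∨ b) ≡ true → (a ≡ true → b ≡ false) → b ≡ not a
  complement {true}          _ disjoint = disjoint refl
  complement {false} {true}  _ _        = refl

swapSplit : ∀ {Γ v0 G₁ G₂} → SplitData Γ v0 G₁ G₂ → SplitData Γ v0 G₂ G₁
swapSplit {G₁ = G₁} {G₂} sd = record
  { V-cover = λ v → trans (∨-comm (v ∈ᵇ Vs G₂) _) (V-cover v)
  ; V-meet  = λ v → trans (∧-comm (v ∈ᵇ Vs G₂) _) (V-meet v)
  ; E-compl = λ e → trans (sym (not-involutive _)) (cong not (sym (E-compl e)))
  }
  where open SplitData sd

module _ {Γ : Graph} {v0 : Fin (nV Γ)} {G₁ G₂ : Subgraph Γ} (sd : SplitData Γ v0 G₁ G₂) where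
  open SplitData sd

  v0∈V₁ : v0 ∈ᵇ Vs G₁ ≡ true
  v0∈V₁ = ∧-trueˡ (trans (V-meet v0) (==-refl v0))

  V₁-off-v0⇒∉V₂ : ∀ {v} → v ∈ᵇ Vs G₁ ≡ true → (v == v0) ≡ false → v ∈ᵇ Vs G₂ ≡ false
  V₁-off-v0⇒∉V₂ {v} v∈V₁ v≢v0 = trans (cong (_∧ v ∈ᵇ Vs G₂) (sym v∈V₁)) (trans (V-meet v) v≢v0)

  vertex-side : ∀ v → v ∈ Vs G₁ ⊎ v ∈ Vs G₂
  vertex-side v with v ∈ᵇ Vs G₁ in a | v ∈ᵇ Vs G₂ in b | V-cover v
  ... | true  | _    | _ = inj₁ (∈ᵇ⇒∈ a)
  ... | false | true | _ = inj₂ (∈ᵇ⇒∈ b)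

  edge-side : ∀ e → e ∈ Es G₁ ⊎ e ∈ Es G₂
  edge-side e with e ∈ᵇ Es G₁ in a
  ... | true  = inj₁ (∈ᵇ⇒∈ a)
  ... | false = inj₂ (∈ᵇ⇒∈ (trans (E-compl e) (cong not a)))

  V-∩ : Vs G₂ ∩ Vs G₁ ≡ ⁅ v0 ⁆
  V-∩ = ∈ᵇ-ext (λ v → trans (∈ᵇ-∩ v (Vs G₂) (Vs G₁))
                  (trans (∧-comm (v ∈ᵇ Vs G₂) _) (trans (V-meet v) (sym (∈ᵇ-⁅⁆ v v0)))))

  E-disjoint : ∀ {e} → e ∈ Es G₁ → e ∉ Es G₂
  E-disjoint {e} e∈E₁ = ∈ᵇ⇒∉ (trans (E-compl e) (cong not (∈⇒∈ᵇ e∈E₁)))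

  V-disjoint-off-v0 : ∀ {v} → v ∈ Vs G₁ → v ≢ v0 → v ∉ Vs G₂
  V-disjoint-off-v0 {v} v∈V₁ v≢v0 = ∈ᵇ⇒∉ (V₁-off-v0⇒∉V₂ (∈⇒∈ᵇ v∈V₁) (≢⇒== v≢v0))

  nonempty-side : ∀ {S T} → Nonempty S ⊎ Nonempty T →
    (Nonempty (S ∩ Vs G₁) ⊎ Nonempty (T ∩ Es G₁)) ⊎ (Nonempty (S ∩ Vs G₂) ⊎ Nonempty (T ∩ Es G₂))
  nonempty-side (inj₁ (v , v∈S)) = [ (λ v∈V₁ → inj₁ (inj₁ (v , x∈p∩q⁺ (v∈S , v∈V₁))))
                                   , (λ v∈V₂ → inj₂ (inj₁ (v , x∈p∩q⁺ (v∈S , v∈V₂)))) ]′ (vertex-side v)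
  nonempty-side (inj₂ (e , e∈T)) = [ (λ e∈E₁ → inj₁ (inj₂ (e , x∈p∩q⁺ (e∈T , e∈E₁))))
                                   , (λ e∈E₂ → inj₂ (inj₂ (e , x∈p∩q⁺ (e∈T , e∈E₂)))) ]′ (edge-side e)

  val-split : ∀ v → val (whole Γ) v ≡ val G₁ v ℕ.+ val G₂ v
  val-split v = trans (Σℕ-cong incident) (Σℕ-+ {nE Γ} _ _)
    where
    incident : ∀ e → (if e ∈ᵇ ⊤ then [ src Γ e == v ] ℕ.+ [ tgt Γ e == v ] else 0) ≡
                     (if e ∈ᵇ Es G₁ then [ src Γ e == v ] ℕ.+ [ tgt Γ e == v ] else 0) ℕ.+
                     (if e ∈ᵇ Es G₂ then [ src Γ e == v ] ℕ.+ [ tgt Γ e == v ] else 0)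
    incident e rewrite ∈ᵇ-⊤ e | E-compl e with e ∈ᵇ Es G₁
    ... | true  = sym (ℕP.+-identityʳ _)
    ... | false = refl

  ∣∣-split : ∀ T → ∣ T ∣ ≡ ∣ T ∩ Es G₁ ∣ ℕ.+ ∣ T ∩ Es G₂ ∣
  ∣∣-split T =
    trans (sym (trans (cong (∣ T ∣ ℕ.+_) (∣⊥∣≡0 (nE Γ))) (ℕP.+-identityʳ _))) (∣∣+∣∣-cong sides)
    where
    sides : ∀ e → [ e ∈ᵇ T ] ℕ.+ [ e ∈ᵇ ⊥ ] ≡ [ e ∈ᵇ (T ∩ Es G₁) ] ℕ.+ [ e ∈ᵇ (T ∩ Es G₂) ]
    sides e rewrite ∈ᵇ-⊥ e | ∈ᵇ-∩ e T (Es G₁) | ∈ᵇ-∩ e T (Es G₂) | E-compl e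
      with e ∈ᵇ T | e ∈ᵇ Es G₁
    ... | true  | true  = refl
    ... | true  | false = refl
    ... | false | _     = refl

  genus-split : genus (whole Γ) ≡ genus G₁ + genus G₂
  genus-split =
    begin
      (+ ∣ ⊤ {nE Γ} ∣ - + ∣ ⊤ {nV Γ} ∣) + 1ℤ
    ≡⟨ cong₂ (λ e v → (e - v) + 1ℤ) (cong +_ edges) vertices ⟩
      (+ ∣ Es G₁ ∣ + + ∣ Es G₂ ∣) - (+ ∣ Vs G₁ ∣ + + ∣ Vs G₂ ∣ - 1ℤ) + 1ℤ
    ≡⟨ regroup (+ ∣ Es G₁ ∣) (+ ∣ Es G₂ ∣) (+ ∣ Vs G₁ ∣) (+ ∣ Vs G₂ ∣) ⟩
      genus G₁ + genus G₂
    ∎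
    where
    open ≡-Reasoning
    regroup : ∀ a b c d → (a + b) - (c + d - 1ℤ) + 1ℤ ≡ (a - c + 1ℤ) + (b - d + 1ℤ)
    regroup = solve-∀
    edges : ∣ ⊤ {nE Γ} ∣ ≡ ∣ Es G₁ ∣ ℕ.+ ∣ Es G₂ ∣
    edges = trans (∣∣-split ⊤) (cong₂ (λ p q → ∣ p ∣ ℕ.+ ∣ q ∣) (∩-identityˡ (Es G₁)) (∩-identityˡ (Es G₂)))
    vertices : + ∣ ⊤ {nV Γ} ∣ ≡ + ∣ Vs G₁ ∣ + + ∣ Vs G₂ ∣ - 1ℤ
    vertices = trans (add-sub-one (+ ∣ ⊤ {nV Γ} ∣)) (cong (_- 1ℤ)
                 (trans (cong +_ (trans (cong (∣ ⊤ {nV Γ} ∣ ℕ.+_) (sym (∣⁅x⁆∣≡1 v0)))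
                                        (∣∣+∣∣-cong counted-twice)))
                        (ℤP.pos-+ ∣ Vs G₁ ∣ ∣ Vs G₂ ∣)))
      where
      add-sub-one : ∀ a → a ≡ a + 1ℤ - 1ℤ
      add-sub-one = solve-∀
      inclusion-exclusion : ∀ b₁ b₂ → (b₁ ∨ b₂) ≡ true → [ true ] ℕ.+ [ b₁ ∧ b₂ ] ≡ [ b₁ ] ℕ.+ [ b₂ ]
      inclusion-exclusion true  true  _ = refl
      inclusion-exclusion true  false _ = refl
      inclusion-exclusion false true  _ = refl
      counted-twice : ∀ v → [ v ∈ᵇ ⊤ ] ℕ.+ [ v ∈ᵇ ⁅ v0 ⁆ ] ≡ [ v ∈ᵇ Vs G₁ ] ℕ.+ [ v ∈ᵇ Vs G₂ ]
      counted-twice v rewrite ∈ᵇ-⊤ v | ∈ᵇ-⁅⁆ v v0 | sym (V-meet v) =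
        inclusion-exclusion (v ∈ᵇ Vs G₁) (v ∈ᵇ Vs G₂) (V-cover v)

  μ-split : ∀ S → twiceμ (whole Γ) S ≡
    twiceμ G₁ (S ∩ Vs G₁) + twiceμ G₂ (S ∩ Vs G₂) + ΣℤOn S (λ v → + [ v == v0 ] + + [ v == v0 ])
  μ-split S = ΣℤOn-∩-split S (Vs G₁) (Vs G₂) _ _ _ _ (λ v _ → at v)
    where
    at : ∀ v → + val (whole Γ) v - + 2 ≡
      (if v ∈ᵇ Vs G₁ then + val G₁ v - + 2 else 0ℤ) + (if v ∈ᵇ Vs G₂ then + val G₂ v - + 2 else 0ℤ)
        + (+ [ v == v0 ] + + [ v == v0 ])
    at v rewrite val-split v | sym (V-meet v) with v ∈ᵇ Vs G₁ in a | v ∈ᵇ Vs G₂ in b | V-cover v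
    ... | true  | true  | _ rewrite ℤP.pos-+ (val G₁ v) (val G₂ v) = both (+ val G₁ v) (+ val G₂ v)
      where both : ∀ m n → m + n - + 2 ≡ (m - + 2) + (n - + 2) + (+ 1 + + 1)
            both = solve-∀
    ... | true  | false | _ rewrite val-outside G₂ b | ℕP.+-identityʳ (val G₁ v) = one (+ val G₁ v)
      where one : ∀ m → m - + 2 ≡ (m - + 2) + 0ℤ + 0ℤ
            one = solve-∀
    ... | false | true  | _ rewrite val-outside G₁ a = one (+ val G₂ v)
      where one : ∀ n → n - + 2 ≡ 0ℤ + (n - + 2) + 0ℤ
            one = solve-∀

module _ {Γ : Graph} where

  ≈PD-sym : ∀ {x y : PseudoDivisor Γ} → x ≈PD y → y ≈PD x
  ≈PD-sym {⟨ _ , _ ⟩} {⟨ _ , _ ⟩} (refl , D≗D') = refl , λ v → sym (D≗D' v)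

  ≈PD-trans : ∀ {x y z : PseudoDivisor Γ} → x ≈PD y → y ≈PD z → x ≈PD z
  ≈PD-trans {⟨ _ , _ ⟩} {⟨ _ , _ ⟩} {⟨ _ , _ ⟩} (refl , D≗D') (refl , D'≗D'') =
    refl , λ v → trans (D≗D' v) (D'≗D'' v)

  σ-cong : ∀ v0 {x₁ x₂ y₁ y₂ : PseudoDivisor Γ} → x₁ ≈PD y₁ → x₂ ≈PD y₂ → σ Γ v0 x₁ x₂ ≈PD σ Γ v0 y₁ y₂
  σ-cong v0 {⟨ _ , _ ⟩} {⟨ _ , _ ⟩} {⟨ _ , _ ⟩} {⟨ _ , _ ⟩} (refl , D₁≗) (refl , D₂≗) =
    refl , λ v → cong₂ (λ a b → a + b + + [ v == v0 ]) (D₁≗ v) (D₂≗ v)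

module _ {Γ : Graph} where

  record SupportedOn (G : Subgraph Γ) (x : PseudoDivisor Γ) : Set where
    field
      exc⊆        : ∀ {e} → e ∈ᵇ exc x ≡ true → e ∈ᵇ Es G ≡ true
      div-outside : ∀ {v} → v ∈ᵇ Vs G ≡ false → div x v ≡ 0ℤ

    exc-outside : ∀ {e} → e ∈ᵇ Es G ≡ false → e ∈ᵇ exc x ≡ false
    exc-outside {e} e∉G with e ∈ᵇ exc x in e∈x
    ... | true  = contradiction (trans (sym (exc⊆ e∈x)) e∉G) true≢false
    ... | false = refl

    div-on : ∀ v → (if v ∈ᵇ Vs G then div x v else 0ℤ) ≡ div x v
    div-on v with v ∈ᵇ Vs G in v∈G
    ... | true  = refl
    ... | false = sym (div-outside v∈G)

  IsQD⇒SupportedOn : ∀ {G v0 x} → IsQD G v0 x → SupportedOn G x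
  IsQD⇒SupportedOn q = record
    { exc⊆        = ∈⇒∈ᵇ ∘ IsQD.edges⊆ q ∘ ∈ᵇ⇒∈
    ; div-outside = λ {v} v∉G → IsQD.support q v (∈ᵇ⇒∉ v∉G)
    }

  -- x ≈ σ(xa , xb), stated pointwise so that xa and xb can exchange roles.
  record IsGluing (v0 : Fin (nV Γ)) (x xa xb : PseudoDivisor Γ) : Set where
    field
      exc-∨ : ∀ e → e ∈ᵇ exc x ≡ (e ∈ᵇ exc xa ∨ e ∈ᵇ exc xb)
      div-+ : ∀ v → div x v ≡ div xa v + div xb v + + [ v == v0 ]

  σ-isGluing : ∀ v0 x₁ x₂ → IsGluing v0 (σ Γ v0 x₁ x₂) x₁ x₂
  σ-isGluing v0 x₁ x₂ = record { exc-∨ = λ e → ∈ᵇ-∪ e (exc x₁) (exc x₂) ; div-+ = λ v → refl }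

  gluing-swap : ∀ {v0 x xa xb} → IsGluing v0 x xa xb → IsGluing v0 x xb xa
  gluing-swap {xa = xa} {xb} g = record
    { exc-∨ = λ e → trans (exc-∨ e) (∨-comm (e ∈ᵇ exc xa) _)
    ; div-+ = λ v → trans (div-+ v) (cong (_+ + [ v == _ ]) (ℤP.+-comm (div xa v) (div xb v)))
    }
    where open IsGluing g

  gluing-resp-≈ : ∀ {v0 x y xa xb} → x ≈PD y → IsGluing v0 x xa xb → IsGluing v0 y xa xb
  gluing-resp-≈ {x = ⟨ ℰ , D ⟩} {⟨ ℰ , D' ⟩} (refl , D≗D') g = record
    { exc-∨ = exc-∨ ; div-+ = λ v → trans (sym (D≗D' v)) (div-+ v) }
    where open IsGluing g

gluing⇒≈σ : ∀ {Γ v0} {x xa xb : PseudoDivisor Γ} → IsGluing v0 x xa xb → σ Γ v0 xa xb ≈PD x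
gluing⇒≈σ {xa = xa} {xb} g =
  ∈ᵇ-ext (λ e → trans (∈ᵇ-∪ e (exc xa) (exc xb)) (sym (IsGluing.exc-∨ g e))) , λ v → sym (IsGluing.div-+ g v)

slackOf : ℤ → ℤ → ℕ → ℤ
slackOf k m d = (+ 2) * k - m + + d

slackOf-cong : ∀ {k k' m m' : ℤ} {d d' : ℕ} → k ≡ k' → m ≡ m' → d ≡ d' → slackOf k m d ≡ slackOf k' m' d'
slackOf-cong refl refl refl = refl

-- The edges of G^ℰ over one edge e that cross a test set: s and t say whether the ends of e lie in S,
-- τ whether v_e ∈ T, and inℰ whether e is subdivided.
crossings : (inℰ s t τ : Bool) → ℕ
crossings inℰ s t τ = if inℰ then [ s xor τ ] ℕ.+ [ t xor τ ] else [ s xor t ]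

module _ {Γ : Graph} where

  δ-summand : Subgraph Γ → Subset (nE Γ) → Subset (nV Γ) → Subset (nE Γ) → Fin (nE Γ) → ℕ
  δ-summand G ℰ S T e = if e ∈ᵇ Es G then crossings (e ∈ᵇ ℰ) (src Γ e ∈ᵇ S) (tgt Γ e ∈ᵇ S) (e ∈ᵇ T) else 0

  δ-summand-outside : ∀ G {ℰ S T e} → e ∈ᵇ Es G ≡ false → δ-summand G ℰ S T e ≡ 0
  δ-summand-outside G e∉G rewrite e∉G = refl

module _ {Γ : Graph} where

  twiceSlack-∅ : ∀ (G : Subgraph Γ) x → twiceSlack G x ⊥ ⊥ ≡ 0ℤ
  twiceSlack-∅ G x =
    slackOf-cong (cong₂ (λ a t → a + + t) (ΣℤOn-⊥ (div x)) (∣⊥∣≡0 (nE Γ))) (ΣℤOn-⊥ (λ v → + val G v - + 2))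
                 (Σℕ-zero no-crossing)
    where
    ΣℤOn-⊥ : ∀ f → ΣℤOn ⊥ f ≡ 0ℤ
    ΣℤOn-⊥ f = Σℤ-zero (λ v → cong (λ b → if b then f v else 0ℤ) (∈ᵇ-⊥ v))
    no-crossing : ∀ e → δ-summand G (exc x) ⊥ ⊥ e ≡ 0
    no-crossing e rewrite ∈ᵇ-⊥ (src Γ e) | ∈ᵇ-⊥ (tgt Γ e) | ∈ᵇ-⊥ e =
      trans (cong (λ n → if e ∈ᵇ Es G then n else 0) (if-same (e ∈ᵇ exc x) 0)) (if-same (e ∈ᵇ Es G) 0)

  twiceμ-total : ∀ (G : Subgraph Γ) → twiceμ G (Vs G) ≡ (+ ∣ Es G ∣ + + ∣ Es G ∣) - (+ ∣ Vs G ∣ + + ∣ Vs G ∣)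
  twiceμ-total G =
    begin
      twiceμ G (Vs G)
    ≡⟨ Σℤ-cong per-vertex ⟩
      Σℤ (λ v → + (if v ∈ᵇ Vs G then val G v else 0) - (+ [ v ∈ᵇ Vs G ] + + [ v ∈ᵇ Vs G ]))
    ≡⟨ Σℤ-- {nV Γ} _ _ ⟩
      Σℤ (λ v → + (if v ∈ᵇ Vs G then val G v else 0)) - Σℤ (λ v → + [ v ∈ᵇ Vs G ] + + [ v ∈ᵇ Vs G ])
    ≡⟨ cong₂ _-_ (trans (Σℤ-pos (λ v → if v ∈ᵇ Vs G then val G v else 0))
                        (trans (cong +_ (handshake G)) (ℤP.pos-+ ∣ Es G ∣ ∣ Es G ∣)))
                 (trans (Σℤ-+ {nV Γ} _ _) (cong₂ _+_ count-V count-V)) ⟩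
      (+ ∣ Es G ∣ + + ∣ Es G ∣) - (+ ∣ Vs G ∣ + + ∣ Vs G ∣)
    ∎
    where
    open ≡-Reasoning
    per-vertex : ∀ v → (if v ∈ᵇ Vs G then + val G v - + 2 else 0ℤ) ≡
                       + (if v ∈ᵇ Vs G then val G v else 0) - (+ [ v ∈ᵇ Vs G ] + + [ v ∈ᵇ Vs G ])
    per-vertex v with v ∈ᵇ Vs G
    ... | true  = refl
    ... | false = refl
    count-V : Σℤ (λ v → + [ v ∈ᵇ Vs G ]) ≡ + ∣ Vs G ∣
    count-V = trans (Σℤ-pos (λ v → [ v ∈ᵇ Vs G ])) (cong +_ (sym (∣∣≡Σℕ (Vs G))))

  twiceSlack-full : ∀ (G : Subgraph Γ) x → degree G x ≡ genus G - 1ℤ → twiceSlack G x (Vs G) (exc x) ≡ 0ℤ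
  twiceSlack-full G x deg =
    trans (slackOf-cong deg (twiceμ-total G) (Σℕ-zero no-crossing))
          (balance (+ ∣ Es G ∣) (+ ∣ Vs G ∣))
    where
    balance : ∀ e v → (+ 2) * ((e - v + 1ℤ) - 1ℤ) - ((e + e) - (v + v)) + 0ℤ ≡ 0ℤ
    balance = solve-∀
    no-crossing : ∀ e → δ-summand G (exc x) (Vs G) (exc x) e ≡ 0
    no-crossing e with e ∈ᵇ Es G in e∈G
    ... | false = refl
    ... | true rewrite proj₁ (endpoints∈ᵇ G e∈G) | proj₂ (endpoints∈ᵇ G e∈G) with e ∈ᵇ exc x
    ...   | true  = refl
    ...   | false = refl

module _ {Γ : Graph} {v0 : Fin (nV Γ)} {G : Subgraph Γ} {x : PseudoDivisor Γ} (q : IsQD G v0 x) where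

  stable-or-empty : ∀ S T → S ⊆ Vs G → T ⊆ exc x → 0ℤ ≤ twiceSlack G x S T
  stable-or-empty S T S⊆G T⊆x with nonempty? S | nonempty? T
  ... | yes S≠∅ | _       = IsQD.stable q S T S⊆G T⊆x (inj₁ S≠∅)
  ... | no _    | yes T≠∅ = IsQD.stable q S T S⊆G T⊆x (inj₂ T≠∅)
  ... | no S=∅  | no T=∅ rewrite Empty-unique S=∅ | Empty-unique T=∅ = ℤP.≤-reflexive (sym (twiceSlack-∅ G x))

  restricted-nonneg : ∀ S T → T ∩ Es G ⊆ exc x → 0ℤ ≤ twiceSlack G x (S ∩ Vs G) (T ∩ Es G)
  restricted-nonneg S T = stable-or-empty _ _ (p∩q⊆q S (Vs G))

  restricted-pos : ∀ S T → T ∩ Es G ⊆ exc x → Nonempty (S ∩ Vs G) ⊎ Nonempty (T ∩ Es G) → v0 ∉ S →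
                   0ℤ < twiceSlack G x (S ∩ Vs G) (T ∩ Es G)
  restricted-pos S T T⊆x ne v0∉S = IsQD.strict q _ _ (p∩q⊆q S (Vs G)) T⊆x ne (v0∉S ∘ p∩q⊆p S (Vs G))

module GluingSide {Γ : Graph} {v0 : Fin (nV Γ)} {Ga Gb : Subgraph Γ} (sd : SplitData Γ v0 Ga Gb)
  {x xa xb : PseudoDivisor Γ} (sa : SupportedOn Ga xa) (sb : SupportedOn Gb xb) (g : IsGluing v0 x xa xb) where
  open SplitData sd
  open IsGluing g

  exc-side : ∀ {e} → e ∈ᵇ Es Ga ≡ true → e ∈ᵇ exc x ≡ e ∈ᵇ exc xa
  exc-side {e} e∈Ga =
    trans (exc-∨ e) (trans (cong (e ∈ᵇ exc xa ∨_) (SupportedOn.exc-outside sb (trans (E-compl e) (cong not e∈Ga))))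
                           (∨-identityʳ _))

  exc-∩ : exc x ∩ Es Ga ≡ exc xa
  exc-∩ = ∈ᵇ-ext restrict
    where
    restrict : ∀ e → e ∈ᵇ (exc x ∩ Es Ga) ≡ e ∈ᵇ exc xa
    restrict e rewrite ∈ᵇ-∩ e (exc x) (Es Ga) with e ∈ᵇ Es Ga in e∈Ga
    ... | true  = trans (∧-identityʳ _) (exc-side e∈Ga)
    ... | false = trans (∧-zeroʳ _) (sym (SupportedOn.exc-outside sa e∈Ga))

  exc-⊆ : exc xa ⊆ exc x
  exc-⊆ {e} e∈xa = ∈ᵇ⇒∈ (trans (exc-∨ e) (cong (_∨ e ∈ᵇ exc xb) (∈⇒∈ᵇ e∈xa)))

  ∩-⊆-exc : ∀ {T} → T ⊆ exc x → T ∩ Es Ga ⊆ exc xa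
  ∩-⊆-exc T⊆x e∈T∩Ga = let (e∈T , e∈Ga) = x∈p∩q⁻ _ _ e∈T∩Ga in
    ∈ᵇ⇒∈ (trans (sym (exc-side (∈⇒∈ᵇ e∈Ga))) (∈⇒∈ᵇ (T⊆x e∈T)))

  crossings-side : ∀ S T {e} → e ∈ᵇ Es Ga ≡ true →
    δ-summand (whole Γ) (exc x) S T e ≡ δ-summand Ga (exc xa) (S ∩ Vs Ga) (T ∩ Es Ga) e
  crossings-side S T {e} e∈Ga
    rewrite ∈ᵇ-⊤ e | e∈Ga | ∈ᵇ-∩ (src Γ e) S (Vs Ga) | ∈ᵇ-∩ (tgt Γ e) S (Vs Ga) | ∈ᵇ-∩ e T (Es Ga)
          | proj₁ (endpoints∈ᵇ Ga e∈Ga) | proj₂ (endpoints∈ᵇ Ga e∈Ga) | e∈Ga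
          | ∧-identityʳ (src Γ e ∈ᵇ S) | ∧-identityʳ (tgt Γ e ∈ᵇ S) | ∧-identityʳ (e ∈ᵇ T)
          | exc-side e∈Ga = refl

module Gluing {Γ : Graph} {v0 : Fin (nV Γ)} {Ga Gb : Subgraph Γ} (sd : SplitData Γ v0 Ga Gb)
  {x xa xb : PseudoDivisor Γ} (sa : SupportedOn Ga xa) (sb : SupportedOn Gb xb) (g : IsGluing v0 x xa xb) where
  open SplitData sd
  open IsGluing g
  module A = GluingSide sd sa sb g
  module B = GluingSide (swapSplit sd) sb sa (gluing-swap g)

  atv0 : Fin (nV Γ) → ℤ
  atv0 v = + [ v == v0 ]

  divisor-split : ∀ S → ΣℤOn S (div x) ≡ ΣℤOn (S ∩ Vs Ga) (div xa) + ΣℤOn (S ∩ Vs Gb) (div xb) + ΣℤOn S atv0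
  divisor-split S = ΣℤOn-∩-split S (Vs Ga) (Vs Gb) _ _ _ _ (λ v _ →
    trans (div-+ v) (cong₂ (λ a b → a + b + atv0 v) (sym (SupportedOn.div-on sa v)) (sym (SupportedOn.div-on sb v))))

  δ-split : ∀ S T → δ (whole Γ) (exc x) S T ≡
                    δ Ga (exc xa) (S ∩ Vs Ga) (T ∩ Es Ga) ℕ.+ δ Gb (exc xb) (S ∩ Vs Gb) (T ∩ Es Gb)
  δ-split S T = trans (Σℕ-cong sides) (Σℕ-+ {nE Γ} _ _)
    where
    sides : ∀ e → δ-summand (whole Γ) (exc x) S T e ≡
                  δ-summand Ga (exc xa) (S ∩ Vs Ga) (T ∩ Es Ga) e ℕ.+ δ-summand Gb (exc xb) (S ∩ Vs Gb) (T ∩ Es Gb) e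
    sides e = by-side (e ∈ᵇ Es Ga) refl
      where
      by-side : ∀ b → e ∈ᵇ Es Ga ≡ b → δ-summand (whole Γ) (exc x) S T e ≡
                δ-summand Ga (exc xa) (S ∩ Vs Ga) (T ∩ Es Ga) e ℕ.+ δ-summand Gb (exc xb) (S ∩ Vs Gb) (T ∩ Es Gb) e
      by-side true  e∈Ga = trans (A.crossings-side S T e∈Ga)
        (sym (trans (cong (_ ℕ.+_) (δ-summand-outside Gb (trans (E-compl e) (cong not e∈Ga)))) (ℕP.+-identityʳ _)))
      by-side false e∉Ga = trans (B.crossings-side S T (trans (E-compl e) (cong not e∉Ga)))
        (sym (cong (ℕ._+ _) (δ-summand-outside Ga e∉Ga)))

  twiceSlack-glue : ∀ S T → twiceSlack (whole Γ) x S T ≡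
    twiceSlack Ga xa (S ∩ Vs Ga) (T ∩ Es Ga) + twiceSlack Gb xb (S ∩ Vs Gb) (T ∩ Es Gb)
  twiceSlack-glue S T =
    trans (slackOf-cong (cong₂ (λ a t → a + + t) (divisor-split S) (∣∣-split sd T))
                        (trans (μ-split sd S) (cong (λ c → μa + μb + c) (ΣℤOn-+ S atv0 atv0)))
                        (δ-split S T))
          (regroup (ΣℤOn (S ∩ Vs Ga) (div xa)) (ΣℤOn (S ∩ Vs Gb) (div xb)) (ΣℤOn S atv0) μa μb
                   ∣ T ∩ Es Ga ∣ ∣ T ∩ Es Gb ∣ (δ Ga (exc xa) (S ∩ Vs Ga) (T ∩ Es Ga)) (δ Gb (exc xb) (S ∩ Vs Gb) (T ∩ Es Gb)))
    where
    μa μb : ℤ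
    μa = twiceμ Ga (S ∩ Vs Ga)
    μb = twiceμ Gb (S ∩ Vs Gb)
    regroup : ∀ A₁ A₂ C M₁ M₂ (t₁ t₂ d₁ d₂ : ℕ) →
      (+ 2) * (A₁ + A₂ + C + + (t₁ ℕ.+ t₂)) - (M₁ + M₂ + (C + C)) + + (d₁ ℕ.+ d₂) ≡
      ((+ 2) * (A₁ + + t₁) - M₁ + + d₁) + ((+ 2) * (A₂ + + t₂) - M₂ + + d₂)
    regroup A₁ A₂ C M₁ M₂ t₁ t₂ d₁ d₂ rewrite ℤP.pos-+ t₁ t₂ | ℤP.pos-+ d₁ d₂ =
      ring A₁ A₂ C M₁ M₂ (+ t₁) (+ t₂) (+ d₁) (+ d₂)
      where
      ring : ∀ A₁ A₂ C M₁ M₂ t₁ t₂ d₁ d₂ →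
        (+ 2) * (A₁ + A₂ + C + (t₁ + t₂)) - (M₁ + M₂ + (C + C)) + (d₁ + d₂) ≡
        ((+ 2) * (A₁ + t₁) - M₁ + d₁) + ((+ 2) * (A₂ + t₂) - M₂ + d₂)
      ring = solve-∀

  degree-glue : degree (whole Γ) x ≡ degree Ga xa + degree Gb xb + 1ℤ
  degree-glue =
    begin
      ΣℤOn ⊤ (div x) + + ∣ exc x ∣
    ≡⟨ cong₂ _+_ (divisor-split ⊤) (cong +_ (∣∣-split sd (exc x))) ⟩
      ΣℤOn (⊤ ∩ Vs Ga) (div xa) + ΣℤOn (⊤ ∩ Vs Gb) (div xb) + ΣℤOn ⊤ atv0 + + (∣ exc x ∩ Es Ga ∣ ℕ.+ ∣ exc x ∩ Es Gb ∣)
    ≡⟨ cong₃ (λ p q c → ΣℤOn p (div xa) + ΣℤOn q (div xb) + c + + (∣ exc x ∩ Es Ga ∣ ℕ.+ ∣ exc x ∩ Es Gb ∣))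
             (∩-identityˡ _) (∩-identityˡ _) atv0-total ⟩
      ΣℤOn (Vs Ga) (div xa) + ΣℤOn (Vs Gb) (div xb) + 1ℤ + + (∣ exc x ∩ Es Ga ∣ ℕ.+ ∣ exc x ∩ Es Gb ∣)
    ≡⟨ cong₂ (λ p q → ΣℤOn (Vs Ga) (div xa) + ΣℤOn (Vs Gb) (div xb) + 1ℤ + + (∣ p ∣ ℕ.+ ∣ q ∣)) A.exc-∩ B.exc-∩ ⟩
      ΣℤOn (Vs Ga) (div xa) + ΣℤOn (Vs Gb) (div xb) + 1ℤ + + (∣ exc xa ∣ ℕ.+ ∣ exc xb ∣)
    ≡⟨ regroup (ΣℤOn (Vs Ga) (div xa)) (ΣℤOn (Vs Gb) (div xb)) ∣ exc xa ∣ ∣ exc xb ∣ ⟩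
      degree Ga xa + degree Gb xb + 1ℤ
    ∎
    where
    open ≡-Reasoning
    atv0-total : ΣℤOn ⊤ atv0 ≡ 1ℤ
    atv0-total = trans (Σℤ-cong (λ v → cong (λ b → if b then atv0 v else 0ℤ) (∈ᵇ-⊤ v)))
                       (trans (Σℤ-pos (λ v → [ v == v0 ])) (cong +_ (Σℕ-point v0 1)))
    regroup : ∀ a b (m n : ℕ) → a + b + 1ℤ + + (m ℕ.+ n) ≡ a + + m + (b + + n) + 1ℤ
    regroup a b m n rewrite ℤP.pos-+ m n = ring a b (+ m) (+ n)
      where
      ring : ∀ a b m n → a + b + 1ℤ + (m + n) ≡ a + m + (b + n) + 1ℤ
      ring = solve-∀

gluing-isQD : ∀ {Γ v0 Ga Gb x xa xb} → SplitData Γ v0 Ga Gb → IsGluing v0 x xa xb →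
              IsQD Ga v0 xa → IsQD Gb v0 xb → IsQD (whole Γ) v0 x
gluing-isQD {Γ} {v0} {Ga} {Gb} {x} {xa} {xb} sd g qa qb = record
  { edges⊆  = λ _ → ∈⊤
  ; support = λ v v∉⊤ → contradiction ∈⊤ v∉⊤
  ; deg     = trans degree-glue (trans (cong₂ (λ a b → a + b + 1ℤ) (IsQD.deg qa) (IsQD.deg qb))
                (trans (regroup (genus Ga) (genus Gb)) (cong (_- 1ℤ) (sym (genus-split sd)))))
  ; stable  = λ S T _ T⊆x _ → subst (0ℤ ≤_) (sym (twiceSlack-glue S T))
      (ℤP.+-mono-≤ (restricted-nonneg qa S T (A.∩-⊆-exc T⊆x)) (restricted-nonneg qb S T (B.∩-⊆-exc T⊆x)))
  ; strict  = λ S T _ T⊆x S∪T≠∅ v0∉S → subst (0ℤ <_) (sym (twiceSlack-glue S T))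
      ([ (λ ne → ℤP.+-mono-<-≤ (restricted-pos qa S T (A.∩-⊆-exc T⊆x) ne v0∉S)
                              (restricted-nonneg qb S T (B.∩-⊆-exc T⊆x)))
       , (λ ne → ℤP.+-mono-≤-< (restricted-nonneg qa S T (A.∩-⊆-exc T⊆x))
                              (restricted-pos qb S T (B.∩-⊆-exc T⊆x) ne v0∉S)) ]′ (nonempty-side sd S∪T≠∅))
  }
  where
  sa : SupportedOn Ga xa
  sa = IsQD⇒SupportedOn qa
  sb : SupportedOn Gb xb
  sb = IsQD⇒SupportedOn qb
  open Gluing sd sa sb g
  regroup : ∀ a b → (a - 1ℤ) + (b - 1ℤ) + 1ℤ ≡ a + b - 1ℤ
  regroup = solve-∀

component-isQD : ∀ {Γ v0 Ga Gb x xa xb} → SplitData Γ v0 Ga Gb → IsGluing v0 x xa xb → IsQD (whole Γ) v0 x →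
  SupportedOn Ga xa → SupportedOn Gb xb → degree Ga xa ≡ genus Ga - 1ℤ → degree Gb xb ≡ genus Gb - 1ℤ →
  IsQD Ga v0 xa
component-isQD {Γ} {v0} {Ga} {Gb} {x} {xa} {xb} sd g q sa sb dega degb = record
  { edges⊆  = ∈ᵇ⇒∈ ∘ SupportedOn.exc⊆ sa ∘ ∈⇒∈ᵇ
  ; support = λ v v∉Ga → SupportedOn.div-outside sa (∉⇒∈ᵇ v∉Ga)
  ; deg     = dega
  ; stable  = stable
  ; strict  = strict
  }
  where
  open Gluing sd sa sb g
  Va Vb : Subset (nV Γ)
  Va = Vs Ga
  Vb = Vs Gb
  Ea Eb : Subset (nE Γ)
  Ea = Es Ga
  Eb = Es Gb
  T⊆Ea : ∀ {T} → T ⊆ exc xa → T ⊆ Ea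
  T⊆Ea T⊆xa = ∈ᵇ⇒∈ ∘ SupportedOn.exc⊆ sa ∘ ∈⇒∈ᵇ ∘ T⊆xa
  xb⊆Eb : exc xb ⊆ Eb
  xb⊆Eb = ∈ᵇ⇒∈ ∘ SupportedOn.exc⊆ sb ∘ ∈⇒∈ᵇ

  strict : ∀ S T → S ⊆ Va → T ⊆ exc xa → Nonempty S ⊎ Nonempty T → v0 ∉ S → 0ℤ < twiceSlack Ga xa S T
  strict S T S⊆Va T⊆xa ne v0∉S =
    subst (0ℤ <_) only-a (IsQD.strict q S T (λ _ → ∈⊤) (A.exc-⊆ ∘ T⊆xa) ne v0∉S)
    where
    only-a : twiceSlack (whole Γ) x S T ≡ twiceSlack Ga xa S T
    only-a = begin
      twiceSlack (whole Γ) x S T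
        ≡⟨ twiceSlack-glue S T ⟩
      twiceSlack Ga xa (S ∩ Va) (T ∩ Ea) + twiceSlack Gb xb (S ∩ Vb) (T ∩ Eb)
        ≡⟨ cong₂ _+_ (cong₂ (twiceSlack Ga xa) (⊆⇒∩≡ S⊆Va) (⊆⇒∩≡ (T⊆Ea T⊆xa)))
                     (cong₂ (twiceSlack Gb xb)
                            (disjoint⇒∩≡⊥ (λ v∈S → V-disjoint-off-v0 sd (S⊆Va v∈S) (λ { refl → v0∉S v∈S })))
                            (disjoint⇒∩≡⊥ (E-disjoint sd ∘ T⊆Ea T⊆xa))) ⟩
      twiceSlack Ga xa S T + twiceSlack Gb xb ⊥ ⊥
        ≡⟨ cong (λ s → twiceSlack Ga xa S T + s) (twiceSlack-∅ Gb xb) ⟩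
      twiceSlack Ga xa S T + 0ℤ
        ≡⟨ ℤP.+-identityʳ _ ⟩
      twiceSlack Ga xa S T
        ∎
      where open ≡-Reasoning

  stable : ∀ S T → S ⊆ Va → T ⊆ exc xa → Nonempty S ⊎ Nonempty T → 0ℤ ≤ twiceSlack Ga xa S T
  stable S T S⊆Va T⊆xa ne with v0 ∈? S
  ... | no v0∉S = ℤP.<⇒≤ (strict S T S⊆Va T⊆xa ne v0∉S)
  -- A test set through v0 is completed by all of Gb, whose total slack vanishes.
  ... | yes v0∈S = subst (0ℤ ≤_) add-b
      (IsQD.stable q (S ∪ Vb) (T ∪ exc xb) (λ _ → ∈⊤)
         (λ e∈ → [ A.exc-⊆ ∘ T⊆xa , B.exc-⊆ ]′ (x∈p∪q⁻ T (exc xb) e∈)) (inj₁ (v0 , p⊆p∪q Vb v0∈S)))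
    where
    open ≡-Reasoning
    add-b : twiceSlack (whole Γ) x (S ∪ Vb) (T ∪ exc xb) ≡ twiceSlack Ga xa S T
    add-b = begin
      twiceSlack (whole Γ) x (S ∪ Vb) (T ∪ exc xb)
        ≡⟨ twiceSlack-glue _ _ ⟩
      twiceSlack Ga xa ((S ∪ Vb) ∩ Va) ((T ∪ exc xb) ∩ Ea) + twiceSlack Gb xb ((S ∪ Vb) ∩ Vb) ((T ∪ exc xb) ∩ Eb)
        ≡⟨ cong₂ _+_ (cong₂ (twiceSlack Ga xa) S-part T-part)
                     (cong₂ (twiceSlack Gb xb) (⊇⇒∩≡ (q⊆p∪q S Vb)) xb-part) ⟩
      twiceSlack Ga xa S T + twiceSlack Gb xb Vb (exc xb)
        ≡⟨ cong (λ s → twiceSlack Ga xa S T + s) (twiceSlack-full Gb xb degb) ⟩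
      twiceSlack Ga xa S T + 0ℤ
        ≡⟨ ℤP.+-identityʳ _ ⟩
      twiceSlack Ga xa S T
        ∎
      where
      S-part : (S ∪ Vb) ∩ Va ≡ S
      S-part = begin
        (S ∪ Vb) ∩ Va       ≡⟨ ∩-distribʳ-∪ Va S Vb ⟩
        (S ∩ Va) ∪ (Vb ∩ Va) ≡⟨ cong₂ _∪_ (⊆⇒∩≡ S⊆Va) (V-∩ sd) ⟩
        S ∪ ⁅ v0 ⁆           ≡⟨ ⊇⇒∪≡ (λ v∈⁅v0⁆ → subst (_∈ S) (sym (x∈⁅y⁆⇒x≡y v0 v∈⁅v0⁆)) v0∈S) ⟩
        S                    ∎
      T-part : (T ∪ exc xb) ∩ Ea ≡ T
      T-part = begin
        (T ∪ exc xb) ∩ Ea         ≡⟨ ∩-distribʳ-∪ Ea T (exc xb) ⟩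
        (T ∩ Ea) ∪ (exc xb ∩ Ea)  ≡⟨ cong₂ _∪_ (⊆⇒∩≡ (T⊆Ea T⊆xa))
                                               (disjoint⇒∩≡⊥ (E-disjoint (swapSplit sd) ∘ xb⊆Eb)) ⟩
        T ∪ ⊥                     ≡⟨ ∪-identityʳ T ⟩
        T                         ∎
      xb-part : (T ∪ exc xb) ∩ Eb ≡ exc xb
      xb-part = begin
        (T ∪ exc xb) ∩ Eb         ≡⟨ ∩-distribʳ-∪ Eb T (exc xb) ⟩
        (T ∩ Eb) ∪ (exc xb ∩ Eb)  ≡⟨ cong₂ _∪_ (disjoint⇒∩≡⊥ (E-disjoint sd ∘ T⊆Ea T⊆xa)) (⊆⇒∩≡ xb⊆Eb) ⟩
        ⊥ ∪ exc xb                ≡⟨ ∪-identityˡ (exc xb) ⟩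
        exc xb                    ∎

module Restriction {Γ : Graph} {v0 : Fin (nV Γ)} {G₁ G₂ : Subgraph Γ} (sd : SplitData Γ v0 G₁ G₂)
  {x : PseudoDivisor Γ} (q : IsQD (whole Γ) v0 x) where
  open SplitData sd

  restrict : Subgraph Γ → ℤ → PseudoDivisor Γ
  restrict G c = ⟨ exc x ∩ Es G , (λ v → if v ∈ᵇ Vs G then (if v == v0 then c else div x v) else 0ℤ) ⟩

  restrict-supported : ∀ G c → SupportedOn G (restrict G c)
  restrict-supported G c = record
    { exc⊆        = λ {e} e∈ → ∧-trueʳ (trans (sym (∈ᵇ-∩ e (exc x) (Es G))) e∈)
    ; div-outside = λ {v} v∉G → cong (λ b → if b then (if v == v0 then c else div x v) else 0ℤ) v∉G
    }

  -- x₁ takes the value at v0 that gives it degree g₁ − 1; x₂ takes the rest, minus the 1 that σ adds back.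
  share₁ : ℤ
  share₁ = genus G₁ - 1ℤ - (ΣℤOn (Vs G₁) (λ v → if v == v0 then 0ℤ else div x v) + + ∣ exc x ∩ Es G₁ ∣)

  x₁ x₂ : PseudoDivisor Γ
  x₁ = restrict G₁ share₁
  x₂ = restrict G₂ (div x v0 - 1ℤ - share₁)

  supported₁ : SupportedOn G₁ x₁
  supported₁ = restrict-supported G₁ share₁

  supported₂ : SupportedOn G₂ x₂
  supported₂ = restrict-supported G₂ (div x v0 - 1ℤ - share₁)

  isGluing : IsGluing v0 x x₁ x₂
  isGluing = record { exc-∨ = exc-∨ ; div-+ = div-+ }
    where
    exc-∨ : ∀ e → e ∈ᵇ exc x ≡ (e ∈ᵇ exc x₁ ∨ e ∈ᵇ exc x₂)
    exc-∨ e rewrite ∈ᵇ-∩ e (exc x) (Es G₁) | ∈ᵇ-∩ e (exc x) (Es G₂) | E-compl e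
      with e ∈ᵇ exc x | e ∈ᵇ Es G₁
    ... | true  | true  = refl
    ... | true  | false = refl
    ... | false | _     = refl
    div-+ : ∀ v → div x v ≡ div x₁ v + div x₂ v + + [ v == v0 ]
    div-+ v with v ≟ v0
    ... | yes refl rewrite v0∈V₁ sd | v0∈V₁ (swapSplit sd) = share (div x v0) share₁
      where
      share : ∀ d a → d ≡ a + (d - 1ℤ - a) + 1ℤ
      share = solve-∀
    ... | no v≢v0 with v ∈ᵇ Vs G₁ in a | v ∈ᵇ Vs G₂ in b | V-cover v | trans (V-meet v) (≢⇒== v≢v0)
    ...   | true  | false | _ | _ = sym (trans (ℤP.+-identityʳ _) (ℤP.+-identityʳ _))
    ...   | false | true  | _ | _ = sym (trans (ℤP.+-identityʳ _) (ℤP.+-identityˡ _))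

  degree₁ : degree G₁ x₁ ≡ genus G₁ - 1ℤ
  degree₁ =
    begin
      ΣℤOn (Vs G₁) (div x₁) + + ∣ exc x₁ ∣
    ≡⟨ cong (_+ + ∣ exc x₁ ∣) (trans (Σℤ-cong split-v0) (Σℤ-+ {nV Γ} _ _)) ⟩
      ΣℤOn (Vs G₁) off-v0 + Σℤ (λ v → if v == v0 then share₁ else 0ℤ) + + ∣ exc x₁ ∣
    ≡⟨ cong (λ a → ΣℤOn (Vs G₁) off-v0 + a + + ∣ exc x₁ ∣) (Σℤ-point v0 share₁) ⟩
      ΣℤOn (Vs G₁) off-v0 + share₁ + + ∣ exc x₁ ∣
    ≡⟨ balance (ΣℤOn (Vs G₁) off-v0) (+ ∣ exc x₁ ∣) (genus G₁) ⟩
      genus G₁ - 1ℤ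
    ∎
    where
    open ≡-Reasoning
    off-v0 : Fin (nV Γ) → ℤ
    off-v0 v = if v == v0 then 0ℤ else div x v
    balance : ∀ n e g → n + (g - 1ℤ - (n + e)) + e ≡ g - 1ℤ
    balance = solve-∀
    split-v0 : ∀ v → (if v ∈ᵇ Vs G₁ then div x₁ v else 0ℤ) ≡
                     (if v ∈ᵇ Vs G₁ then off-v0 v else 0ℤ) + (if v == v0 then share₁ else 0ℤ)
    split-v0 v with v ≟ v0
    ... | yes refl rewrite v0∈V₁ sd = sym (ℤP.+-identityˡ share₁)
    ... | no _ with v ∈ᵇ Vs G₁
    ...   | true  = sym (ℤP.+-identityʳ _)
    ...   | false = refl

  degree₂ : degree G₂ x₂ ≡ genus G₂ - 1ℤ
  degree₂ = cancel {degree G₁ x₁} {degree G₂ x₂} {genus G₁} {genus G₂}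
              (trans (sym (Gluing.degree-glue sd supported₁ supported₂ isGluing))
                     (trans (IsQD.deg q) (cong (_- 1ℤ) (genus-split sd))))
              degree₁
    where
    cancel : ∀ {a b g₁ g₂} → a + b + 1ℤ ≡ g₁ + g₂ - 1ℤ → a ≡ g₁ - 1ℤ → b ≡ g₂ - 1ℤ
    cancel {b = b} {g₁} {g₂} h refl =
      trans (solve-b (g₁ - 1ℤ) b) (trans (cong (λ s → s - (g₁ - 1ℤ) - 1ℤ) h) (solve-g g₁ g₂))
      where
      solve-b : ∀ a b → b ≡ a + b + 1ℤ - a - 1ℤ
      solve-b = solve-∀
      solve-g : ∀ g₁ g₂ → g₁ + g₂ - 1ℤ - (g₁ - 1ℤ) - 1ℤ ≡ g₂ - 1ℤ
      solve-g = solve-∀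

  x₁-isQD : IsQD G₁ v0 x₁
  x₁-isQD = component-isQD sd isGluing q supported₁ supported₂ degree₁ degree₂

  x₂-isQD : IsQD G₂ v0 x₂
  x₂-isQD = component-isQD (swapSplit sd) (gluing-swap isGluing) q
              supported₂ supported₁ degree₂ degree₁

fibreSize : (Γ : Graph) → Subset (nE Γ) → Subset (nE Γ) → (Fin (nE Γ) → Fin (nV Γ)) → Fin (nV Γ) → ℕ
fibreSize Γ ℰ ℰ' φ v = Σℕ (λ e → [ (e ∈ᵇ ℰ) ∧ not (e ∈ᵇ ℰ') ∧ (φ e == v) ])

module _ {Γ : Graph} where

  fibreSize-self : ∀ ℰ φ v → fibreSize Γ ℰ ℰ φ v ≡ 0
  fibreSize-self ℰ φ v = Σℕ-zero {nE Γ} (λ e → none (e ∈ᵇ ℰ))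
    where
    none : ∀ b {c} → [ b ∧ not b ∧ c ] ≡ 0
    none true  = refl
    none false = refl

  fibreSize-outside : ∀ ℰ ℰ' φ (V : Subset (nV Γ)) → (∀ {e} → e ∈ᵇ ℰ ≡ true → e ∈ᵇ ℰ' ≡ false → φ e ∈ᵇ V ≡ true) →
                      ∀ {v} → v ∈ᵇ V ≡ false → fibreSize Γ ℰ ℰ' φ v ≡ 0
  fibreSize-outside ℰ ℰ' φ V φ∈V {v} v∉V = Σℕ-zero {nE Γ} term
    where
    term : ∀ e → [ (e ∈ᵇ ℰ) ∧ not (e ∈ᵇ ℰ') ∧ (φ e == v) ] ≡ 0
    term e with e ∈ᵇ ℰ in e∈ℰ | e ∈ᵇ ℰ' in e∈ℰ'
    ... | true  | false rewrite ∈ᵇ-distinct (φ∈V e∈ℰ e∈ℰ') v∉V = refl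
    ... | true  | true  = refl
    ... | false | _     = refl

  fibreSize-total : ∀ ℰ ℰ' φ (V : Subset (nV Γ)) → (∀ {e} → e ∈ᵇ ℰ ≡ true → e ∈ᵇ ℰ' ≡ false → φ e ∈ᵇ V ≡ true) →
                    Σℕ (λ v → if v ∈ᵇ V then fibreSize Γ ℰ ℰ' φ v else 0) ≡ ∣ ℰ ─ ℰ' ∣
  fibreSize-total ℰ ℰ' φ V φ∈V =
    begin
      Σℕ (λ v → if v ∈ᵇ V then fibreSize Γ ℰ ℰ' φ v else 0)
    ≡⟨ Σℕ-cong (λ v → if-Σℕ (v ∈ᵇ V) (λ e → [ (e ∈ᵇ ℰ) ∧ not (e ∈ᵇ ℰ') ∧ (φ e == v) ])) ⟩
      Σℕ (λ v → Σℕ (λ e → if v ∈ᵇ V then [ (e ∈ᵇ ℰ) ∧ not (e ∈ᵇ ℰ') ∧ (φ e == v) ] else 0))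
    ≡⟨ Σℕ-swap (λ v e → if v ∈ᵇ V then [ (e ∈ᵇ ℰ) ∧ not (e ∈ᵇ ℰ') ∧ (φ e == v) ] else 0) ⟩
      Σℕ (λ e → Σℕ (λ v → if v ∈ᵇ V then [ (e ∈ᵇ ℰ) ∧ not (e ∈ᵇ ℰ') ∧ (φ e == v) ] else 0))
    ≡⟨ Σℕ-cong column ⟩
      Σℕ (λ e → [ e ∈ᵇ (ℰ ─ ℰ') ])
    ≡⟨ sym (∣∣≡Σℕ (ℰ ─ ℰ')) ⟩
      ∣ ℰ ─ ℰ' ∣
    ∎
    where
    open ≡-Reasoning
    column : ∀ e → Σℕ (λ v → if v ∈ᵇ V then [ (e ∈ᵇ ℰ) ∧ not (e ∈ᵇ ℰ') ∧ (φ e == v) ] else 0) ≡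
                   [ e ∈ᵇ (ℰ ─ ℰ') ]
    column e rewrite ∈ᵇ-─ e ℰ ℰ' with e ∈ᵇ ℰ in e∈ℰ | e ∈ᵇ ℰ' in e∈ℰ'
    ... | true  | false = trans (Σℕ-δ V (φ e)) (cong [_] (φ∈V e∈ℰ e∈ℰ'))
    ... | true  | true  = Σℕ-zero {nV Γ} (λ v → if-same (v ∈ᵇ V) 0)
    ... | false | _     = Σℕ-zero {nV Γ} (λ v → if-same (v ∈ᵇ V) 0)

module _ {Γ : Graph} {G : Subgraph Γ} where

  ≈⇒PDLeq : ∀ {x y} → x ≈PD y → PDLeq G x y
  ≈⇒PDLeq {⟨ ℰ , D ⟩} {⟨ ℰ , D' ⟩} (refl , D≗D') =
    (λ e∈ℰ → e∈ℰ) , src Γ , (λ _ _ _ → inj₁ refl) ,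
    λ v _ → trans (D≗D' v) (sym (trans (cong (λ n → D' v + + n) (fibreSize-self {Γ} ℰ (src Γ) v)) (ℤP.+-identityʳ _)))


  PDLeq-same-exc⇒≈ : ∀ {x y} → SupportedOn G x → SupportedOn G y → exc x ≡ exc y → PDLeq G x y → x ≈PD y
  PDLeq-same-exc⇒≈ {⟨ ℰ , D ⟩} {⟨ ℰ , D' ⟩} sx sy refl (_ , φ , _ , vals) = refl , value
    where
    value : ∀ v → D v ≡ D' v
    value v with v ∈ᵇ Vs G in v∈G
    ... | true  = trans (vals v (∈ᵇ⇒∈ v∈G))
                        (trans (cong (λ n → D' v + + n) (fibreSize-self {Γ} ℰ φ v)) (ℤP.+-identityʳ _))
    ... | false = trans (SupportedOn.div-outside sx v∈G) (sym (SupportedOn.div-outside sy v∈G))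

  PDLeq-antisym : ∀ {x y} → SupportedOn G x → SupportedOn G y → PDLeq G x y → PDLeq G y x → x ≈PD y
  PDLeq-antisym sx sy x≤y y≤x = PDLeq-same-exc⇒≈ sx sy (⊆-antisym (proj₁ x≤y) (proj₁ y≤x)) x≤y

  PDLeq-values : ∀ {x y} → SupportedOn G x → SupportedOn G y → (x≤y : PDLeq G x y) →
    ∀ v → div x v ≡ div y v + + fibreSize Γ (exc y) (exc x) (proj₁ (proj₂ x≤y)) v
  PDLeq-values {x} {y} sx sy (_ , φ , endp , vals) v with v ∈ᵇ Vs G in v∈G
  ... | true  = vals v (∈ᵇ⇒∈ v∈G)
  ... | false = begin
      div x v                                      ≡⟨ SupportedOn.div-outside sx v∈G ⟩
      0ℤ                                           ≡⟨ sym (SupportedOn.div-outside sy v∈G) ⟩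
      div y v                                      ≡⟨ sym (ℤP.+-identityʳ _) ⟩
      div y v + + 0                                ≡⟨ cong (λ n → div y v + + n)
                                                           (sym (fibreSize-outside {Γ} _ _ φ (Vs G) φ∈G v∈G)) ⟩
      div y v + + fibreSize Γ (exc y) (exc x) φ v  ∎
    where
    open ≡-Reasoning
    φ∈G : ∀ {e} → e ∈ᵇ exc y ≡ true → e ∈ᵇ exc x ≡ false → φ e ∈ᵇ Vs G ≡ true
    φ∈G e∈y e∉x = endpoint∈ᵇ G (SupportedOn.exc⊆ sy e∈y) (endp _ (∈ᵇ⇒∈ e∈y) (∈ᵇ⇒∉ e∉x))

  PDLeq-value-at : ∀ {a ℰ' ℰ D' D φ} → a ∈ᵇ Vs G ≡ true → ℰ' ⊆ ℰ →
    (∀ {e} → e ∈ᵇ ℰ ≡ true → e ∈ᵇ ℰ' ≡ false → φ e ∈ᵇ Vs G ≡ true) →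
    degree G ⟨ ℰ' , D' ⟩ ≡ degree G ⟨ ℰ , D ⟩ →
    (∀ {v} → v ∈ᵇ Vs G ≡ true → v ≢ a → D' v ≡ D v + + fibreSize Γ ℰ ℰ' φ v) →
    D' a ≡ D a + + fibreSize Γ ℰ ℰ' φ a
  PDLeq-value-at {a} {ℰ'} {ℰ} {D'} {D} {φ} a∈G ℰ'⊆ℰ φ∈G deg off-a = ΣℤOn-determines a∈G off-a sums
    where
    V : Subset (nV Γ)
    V = Vs G
    sums : ΣℤOn V D' ≡ ΣℤOn V (λ v → D v + + fibreSize Γ ℰ ℰ' φ v)
    sums = +-cancelʳ (+ ∣ ℰ' ∣) _ _ $
      begin
        ΣℤOn V D' + + ∣ ℰ' ∣
      ≡⟨ deg ⟩
        ΣℤOn V D + + ∣ ℰ ∣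
      ≡⟨ cong (λ n → ΣℤOn V D + + n) (sym (∣─∣+∣∣ ℰ'⊆ℰ)) ⟩
        ΣℤOn V D + + (∣ ℰ ─ ℰ' ∣ ℕ.+ ∣ ℰ' ∣)
      ≡⟨ cong (λ s → ΣℤOn V D + s) (ℤP.pos-+ ∣ ℰ ─ ℰ' ∣ ∣ ℰ' ∣) ⟩
        ΣℤOn V D + (+ ∣ ℰ ─ ℰ' ∣ + + ∣ ℰ' ∣)
      ≡⟨ sym (ℤP.+-assoc (ΣℤOn V D) _ _) ⟩
        ΣℤOn V D + + ∣ ℰ ─ ℰ' ∣ + + ∣ ℰ' ∣
      ≡⟨ cong (λ s → ΣℤOn V D + s + + ∣ ℰ' ∣) (sym fibres) ⟩
        ΣℤOn V D + ΣℤOn V (λ v → + fibreSize Γ ℰ ℰ' φ v) + + ∣ ℰ' ∣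
      ≡⟨ cong (_+ + ∣ ℰ' ∣) (sym (ΣℤOn-+ V D _)) ⟩
        ΣℤOn V (λ v → D v + + fibreSize Γ ℰ ℰ' φ v) + + ∣ ℰ' ∣
      ∎
      where
      open ≡-Reasoning
      fibres : ΣℤOn V (λ v → + fibreSize Γ ℰ ℰ' φ v) ≡ + ∣ ℰ ─ ℰ' ∣
      fibres = trans (Σℤ-cong (λ v → if-pos (v ∈ᵇ V)))
                     (trans (Σℤ-pos (λ v → if v ∈ᵇ V then fibreSize Γ ℰ ℰ' φ v else 0))
                            (cong +_ (fibreSize-total {Γ} ℰ ℰ' φ V φ∈G)))
        where
        if-pos : ∀ {n} b → (if b then + n else 0ℤ) ≡ + (if b then n else 0)
        if-pos true  = refl
        if-pos false = refl

module Order {Γ : Graph} {v0 : Fin (nV Γ)} {Ga Gb : Subgraph Γ} (sd : SplitData Γ v0 Ga Gb)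
  {x xa xb y ya yb : PseudoDivisor Γ} (gx : IsGluing v0 x xa xb) (gy : IsGluing v0 y ya yb)
  (sxa : SupportedOn Ga xa) (sxb : SupportedOn Gb xb) (sya : SupportedOn Ga ya) (syb : SupportedOn Gb yb) where
  open SplitData sd
  module XA = GluingSide sd sxa sxb gx
  module YA = GluingSide sd sya syb gy
  module XB = GluingSide (swapSplit sd) sxb sxa (gluing-swap gx)
  module YB = GluingSide (swapSplit sd) syb sya (gluing-swap gy)

  fibreSize-split : ∀ φ φa φb →
    (∀ {e} → e ∈ᵇ Es Ga ≡ true → φ e ≡ φa e) → (∀ {e} → e ∈ᵇ Es Ga ≡ false → φ e ≡ φb e) →
    ∀ v → fibreSize Γ (exc y) (exc x) φ v ≡ fibreSize Γ (exc ya) (exc xa) φa v ℕ.+ fibreSize Γ (exc yb) (exc xb) φb v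
  fibreSize-split φ φa φb φ≗φa φ≗φb v = trans (Σℕ-cong (λ e → by-side e (e ∈ᵇ Es Ga) refl)) (Σℕ-+ {nE Γ} _ _)
    where
    by-side : ∀ e b → e ∈ᵇ Es Ga ≡ b →
      [ (e ∈ᵇ exc y) ∧ not (e ∈ᵇ exc x) ∧ (φ e == v) ] ≡
      [ (e ∈ᵇ exc ya) ∧ not (e ∈ᵇ exc xa) ∧ (φa e == v) ] ℕ.+ [ (e ∈ᵇ exc yb) ∧ not (e ∈ᵇ exc xb) ∧ (φb e == v) ]
    by-side e true e∈Ga
      rewrite YA.exc-side e∈Ga | XA.exc-side e∈Ga | φ≗φa e∈Ga
            | SupportedOn.exc-outside syb (trans (E-compl e) (cong not e∈Ga)) = sym (ℕP.+-identityʳ _)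
    by-side e false e∉Ga
      rewrite YB.exc-side (trans (E-compl e) (cong not e∉Ga)) | XB.exc-side (trans (E-compl e) (cong not e∉Ga))
            | φ≗φb e∉Ga | SupportedOn.exc-outside sya e∉Ga = refl

  PDLeq-reflect : degree Ga xa ≡ degree Ga ya → PDLeq (whole Γ) x y → PDLeq Ga xa ya
  PDLeq-reflect deg (x⊆y , φ , endp , vals) = xa⊆ya , φ , endpa , valsa
    where
    open ≡-Reasoning
    xa⊆ya : exc xa ⊆ exc ya
    xa⊆ya {e} e∈xa =
      ∈ᵇ⇒∈ (trans (sym (YA.exc-side (SupportedOn.exc⊆ sxa (∈⇒∈ᵇ e∈xa)))) (∈⇒∈ᵇ (x⊆y (XA.exc-⊆ e∈xa))))

    endpa : ∀ e → e ∈ exc ya → e ∉ exc xa → (φ e ≡ src Γ e) ⊎ (φ e ≡ tgt Γ e)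
    endpa e e∈ya e∉xa = endp e (YA.exc-⊆ e∈ya)
      (λ e∈x → e∉xa (∈ᵇ⇒∈ (trans (sym (XA.exc-side (SupportedOn.exc⊆ sya (∈⇒∈ᵇ e∈ya)))) (∈⇒∈ᵇ e∈x))))

    φ∈Va : ∀ {e} → e ∈ᵇ exc ya ≡ true → e ∈ᵇ exc xa ≡ false → φ e ∈ᵇ Vs Ga ≡ true
    φ∈Va e∈ya e∉xa = endpoint∈ᵇ Ga (SupportedOn.exc⊆ sya e∈ya) (endpa _ (∈ᵇ⇒∈ e∈ya) (∈ᵇ⇒∉ e∉xa))

    φ∈Vb : ∀ {e} → e ∈ᵇ exc yb ≡ true → e ∈ᵇ exc xb ≡ false → φ e ∈ᵇ Vs Gb ≡ true
    φ∈Vb {e} e∈yb e∉xb = endpoint∈ᵇ Gb e∈Gb (endp e (YB.exc-⊆ (∈ᵇ⇒∈ e∈yb))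
      (λ e∈x → true≢false (trans (sym (∈⇒∈ᵇ e∈x)) (trans (XB.exc-side e∈Gb) e∉xb))))
      where
      e∈Gb : e ∈ᵇ Es Gb ≡ true
      e∈Gb = SupportedOn.exc⊆ syb e∈yb

    off-v0 : ∀ {v} → v ∈ᵇ Vs Ga ≡ true → v ≢ v0 → div xa v ≡ div ya v + + fibreSize Γ (exc ya) (exc xa) φ v
    off-v0 {v} v∈Va v≢v0 =
      begin
        div xa v
      ≡⟨ sym (trans (drop-zeros (div xa v) 0) (ℤP.+-identityʳ _)) ⟩
        div xa v + 0ℤ + 0ℤ + + 0
      ≡⟨ cong₂ (λ d k → div xa v + d + k + + 0) (sym (SupportedOn.div-outside sxb v∉Vb)) (sym k≡0) ⟩
        div xa v + div xb v + + [ v == v0 ] + 0ℤ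
      ≡⟨ trans (ℤP.+-identityʳ _) (sym (IsGluing.div-+ gx v)) ⟩
        div x v
      ≡⟨ vals v ∈⊤ ⟩
        div y v + + fibreSize Γ (exc y) (exc x) φ v
      ≡⟨ cong₂ (λ d n → d + + n) (IsGluing.div-+ gy v) (fibreSize-split φ φ φ (λ _ → refl) (λ _ → refl) v) ⟩
        div ya v + div yb v + + [ v == v0 ] + + (fibreSize Γ (exc ya) (exc xa) φ v ℕ.+ fibreSize Γ (exc yb) (exc xb) φ v)
      ≡⟨ cong₃ (λ d k n → div ya v + d + k + + (fibreSize Γ (exc ya) (exc xa) φ v ℕ.+ n))
               (SupportedOn.div-outside syb v∉Vb) k≡0 (fibreSize-outside {Γ} (exc yb) (exc xb) φ (Vs Gb) φ∈Vb v∉Vb) ⟩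
        div ya v + 0ℤ + 0ℤ + + (fibreSize Γ (exc ya) (exc xa) φ v ℕ.+ 0)
      ≡⟨ drop-zeros (div ya v) (fibreSize Γ (exc ya) (exc xa) φ v) ⟩
        div ya v + + fibreSize Γ (exc ya) (exc xa) φ v
      ∎
      where
      v∉Vb : v ∈ᵇ Vs Gb ≡ false
      v∉Vb = V₁-off-v0⇒∉V₂ sd v∈Va (≢⇒== v≢v0)
      k≡0 : + [ v == v0 ] ≡ 0ℤ
      k≡0 = cong (λ b → + [ b ]) (≢⇒== v≢v0)
      drop-zeros : ∀ d n → d + 0ℤ + 0ℤ + + (n ℕ.+ 0) ≡ d + + n
      drop-zeros d n rewrite ℕP.+-identityʳ n | ℤP.+-identityʳ d | ℤP.+-identityʳ d = refl

    valsa : ∀ v → v ∈ Vs Ga → div xa v ≡ div ya v + + fibreSize Γ (exc ya) (exc xa) φ v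
    valsa v v∈Va with v ≟ v0
    ... | yes refl = PDLeq-value-at {G = Ga} (v0∈V₁ sd) xa⊆ya φ∈Va deg off-v0
    ... | no v≢v0  = off-v0 (∈⇒∈ᵇ v∈Va) v≢v0

  PDLeq-glue : PDLeq Ga xa ya → PDLeq Gb xb yb → PDLeq (whole Γ) x y
  PDLeq-glue xa≤ya@(xa⊆ya , φa , endpa , _) xb≤yb@(xb⊆yb , φb , endpb , _) = x⊆y , φ , endp , vals
    where
    φ : Fin (nE Γ) → Fin (nV Γ)
    φ e = if e ∈ᵇ Es Ga then φa e else φb e

    x⊆y : exc x ⊆ exc y
    x⊆y {e} e∈x =
      [ (λ e∈Ga → YA.exc-⊆ (xa⊆ya (∈ᵇ⇒∈ (trans (sym (XA.exc-side (∈⇒∈ᵇ e∈Ga))) (∈⇒∈ᵇ e∈x)))))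
      , (λ e∈Gb → YB.exc-⊆ (xb⊆yb (∈ᵇ⇒∈ (trans (sym (XB.exc-side (∈⇒∈ᵇ e∈Gb))) (∈⇒∈ᵇ e∈x))))) ]′ (edge-side sd e)

    endp : ∀ e → e ∈ exc y → e ∉ exc x → (φ e ≡ src Γ e) ⊎ (φ e ≡ tgt Γ e)
    endp e e∈y e∉x with e ∈ᵇ Es Ga in e∈Ga
    ... | true  = endpa e (∈ᵇ⇒∈ (trans (sym (YA.exc-side e∈Ga)) (∈⇒∈ᵇ e∈y)))
                          (λ e∈xa → e∉x (∈ᵇ⇒∈ (trans (XA.exc-side e∈Ga) (∈⇒∈ᵇ e∈xa))))
    ... | false = endpb e (∈ᵇ⇒∈ (trans (sym (YB.exc-side e∈Gb)) (∈⇒∈ᵇ e∈y)))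
                          (λ e∈xb → e∉x (∈ᵇ⇒∈ (trans (XB.exc-side e∈Gb) (∈⇒∈ᵇ e∈xb))))
      where
      e∈Gb : e ∈ᵇ Es Gb ≡ true
      e∈Gb = trans (E-compl e) (cong not e∈Ga)

    vals : ∀ v → v ∈ ⊤ → div x v ≡ div y v + + fibreSize Γ (exc y) (exc x) φ v
    vals v _ = begin
      div x v
        ≡⟨ IsGluing.div-+ gx v ⟩
      div xa v + div xb v + + [ v == v0 ]
        ≡⟨ cong₂ (λ a b → a + b + + [ v == v0 ]) (PDLeq-values sxa sya xa≤ya v) (PDLeq-values sxb syb xb≤yb v) ⟩
      (div ya v + + fa) + (div yb v + + fb) + + [ v == v0 ]
        ≡⟨ regroup (div ya v) (div yb v) (+ [ v == v0 ]) fa fb ⟩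
      div ya v + div yb v + + [ v == v0 ] + + (fa ℕ.+ fb)
        ≡⟨ cong₂ (λ d n → d + + n) (sym (IsGluing.div-+ gy v))
                 (sym (fibreSize-split φ φa φb (λ e∈Ga → cong (λ b → if b then _ else _) e∈Ga)
                                                (λ e∉Ga → cong (λ b → if b then _ else _) e∉Ga) v)) ⟩
      div y v + + fibreSize Γ (exc y) (exc x) φ v
        ∎
      where
      open ≡-Reasoning
      fa fb : ℕ
      fa = fibreSize Γ (exc ya) (exc xa) φa v
      fb = fibreSize Γ (exc yb) (exc xb) φb v
      regroup : ∀ a b k (m n : ℕ) → (a + + m) + (b + + n) + k ≡ a + b + k + + (m ℕ.+ n)
      regroup a b k m n rewrite ℤP.pos-+ m n = ring a b k (+ m) (+ n)
        where
        ring : ∀ a b k m n → (a + m) + (b + n) + k ≡ a + b + k + (m + n)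
        ring = solve-∀

module _ {Γ : Graph} {v0 : Fin (nV Γ)} {G₁ G₂ : Subgraph Γ} (sd : SplitData Γ v0 G₁ G₂) where

  gluing-reflects-≤ : ∀ {x x₁ x₂ y y₁ y₂} → IsGluing v0 x x₁ x₂ → IsGluing v0 y y₁ y₂ →
    IsQD G₁ v0 x₁ → IsQD G₂ v0 x₂ → IsQD G₁ v0 y₁ → IsQD G₂ v0 y₂ →
    PDLeq (whole Γ) x y → PDLeq G₁ x₁ y₁ × PDLeq G₂ x₂ y₂
  gluing-reflects-≤ gx gy qx₁ qx₂ qy₁ qy₂ x≤y =
    Order.PDLeq-reflect sd gx gy (IsQD⇒SupportedOn qx₁) (IsQD⇒SupportedOn qx₂)
      (IsQD⇒SupportedOn qy₁) (IsQD⇒SupportedOn qy₂) (trans (IsQD.deg qx₁) (sym (IsQD.deg qy₁))) x≤y ,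
    Order.PDLeq-reflect (swapSplit sd) (gluing-swap gx) (gluing-swap gy) (IsQD⇒SupportedOn qx₂) (IsQD⇒SupportedOn qx₁)
      (IsQD⇒SupportedOn qy₂) (IsQD⇒SupportedOn qy₁) (trans (IsQD.deg qx₂) (sym (IsQD.deg qy₂))) x≤y

  σ-isQD : ∀ x₁ x₂ → IsQD G₁ v0 x₁ → IsQD G₂ v0 x₂ → IsQD (whole Γ) v0 (σ Γ v0 x₁ x₂)
  σ-isQD x₁ x₂ = gluing-isQD sd (σ-isGluing v0 x₁ x₂)

  σ-injective : ∀ x₁ x₂ y₁ y₂ → IsQD G₁ v0 x₁ → IsQD G₂ v0 x₂ → IsQD G₁ v0 y₁ → IsQD G₂ v0 y₂ →
    σ Γ v0 x₁ x₂ ≈PD σ Γ v0 y₁ y₂ → (x₁ ≈PD y₁) × (x₂ ≈PD y₂)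
  σ-injective x₁ x₂ y₁ y₂ qx₁ qx₂ qy₁ qy₂ σx≈σy =
    PDLeq-antisym (IsQD⇒SupportedOn qx₁) (IsQD⇒SupportedOn qy₁) (proj₁ x≤y) (proj₁ y≤x) ,
    PDLeq-antisym (IsQD⇒SupportedOn qx₂) (IsQD⇒SupportedOn qy₂) (proj₂ x≤y) (proj₂ y≤x)
    where
    gx : IsGluing v0 (σ Γ v0 x₁ x₂) x₁ x₂
    gx = σ-isGluing v0 x₁ x₂
    gy : IsGluing v0 (σ Γ v0 y₁ y₂) y₁ y₂
    gy = σ-isGluing v0 y₁ y₂
    x≤y : PDLeq G₁ x₁ y₁ × PDLeq G₂ x₂ y₂
    x≤y = gluing-reflects-≤ gx gy qx₁ qx₂ qy₁ qy₂ (≈⇒PDLeq {G = whole Γ} σx≈σy)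
    y≤x : PDLeq G₁ y₁ x₁ × PDLeq G₂ y₂ x₂
    y≤x = gluing-reflects-≤ gy gx qy₁ qy₂ qx₁ qx₂ (≈⇒PDLeq {G = whole Γ} (≈PD-sym {Γ} σx≈σy))

  σ-surjective : ∀ x → IsQD (whole Γ) v0 x →
    ∃[ x₁ ] ∃[ x₂ ] (IsQD G₁ v0 x₁ × IsQD G₂ v0 x₂ × (σ Γ v0 x₁ x₂ ≈PD x))
  σ-surjective x q = x₁ , x₂ , x₁-isQD , x₂-isQD , gluing⇒≈σ isGluing
    where open Restriction sd q

  σ-≤-iff : ∀ x₁ x₂ y₁ y₂ → IsQD G₁ v0 x₁ → IsQD G₂ v0 x₂ → IsQD G₁ v0 y₁ → IsQD G₂ v0 y₂ →
    PDLeq (whole Γ) (σ Γ v0 x₁ x₂) (σ Γ v0 y₁ y₂) ⇔ (PDLeq G₁ x₁ y₁ × PDLeq G₂ x₂ y₂)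
  σ-≤-iff x₁ x₂ y₁ y₂ qx₁ qx₂ qy₁ qy₂ = mk⇔ (gluing-reflects-≤ gx gy qx₁ qx₂ qy₁ qy₂) (uncurry glue)
    where
    gx : IsGluing v0 (σ Γ v0 x₁ x₂) x₁ x₂
    gx = σ-isGluing v0 x₁ x₂
    gy : IsGluing v0 (σ Γ v0 y₁ y₂) y₁ y₂
    gy = σ-isGluing v0 y₁ y₂
    open Order sd gx gy (IsQD⇒SupportedOn qx₁) (IsQD⇒SupportedOn qx₂) (IsQD⇒SupportedOn qy₁) (IsQD⇒SupportedOn qy₂)
      renaming (PDLeq-glue to glue)

  σ-deletion : ∀ {e} → e ∈ Es G₁ → ∀ {ℰ ℰ₁ ℰ₂ D D₁ D₂ D̄} →
    IsQD G₁ v0 ⟨ ℰ₁ , D₁ ⟩ → IsQD G₂ v0 ⟨ ℰ₂ , D₂ ⟩ →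
    σ Γ v0 ⟨ ℰ₁ , D₁ ⟩ ⟨ ℰ₂ , D₂ ⟩ ≈PD ⟨ ℰ , D ⟩ →
    IsQD (whole Γ) v0 ⟨ ℰ ─ ⁅ e ⁆ , D̄ ⟩ → PDLeq (whole Γ) ⟨ ℰ ─ ⁅ e ⁆ , D̄ ⟩ ⟨ ℰ , D ⟩ →
    Σ (Fin (nV Γ) → ℤ) λ D̄₁ → (IsQD G₁ v0 ⟨ ℰ₁ ─ ⁅ e ⁆ , D̄₁ ⟩
             × PDLeq G₁ ⟨ ℰ₁ ─ ⁅ e ⁆ , D̄₁ ⟩ ⟨ ℰ₁ , D₁ ⟩
             × (σ Γ v0 ⟨ ℰ₁ ─ ⁅ e ⁆ , D̄₁ ⟩ ⟨ ℰ₂ , D₂ ⟩ ≈PD ⟨ ℰ ─ ⁅ e ⁆ , D̄ ⟩))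
  σ-deletion {e} e∈E₁ {ℰ} {ℰ₁} {ℰ₂} {D} {D₁} {D₂} {D̄} q₁ q₂ σx≈x q̄ x̄≤x =
    div y.x₁ , subst (λ p → IsQD G₁ v0 ⟨ p , div y.x₁ ⟩) exc₁ y.x₁-isQD
             , subst (λ p → PDLeq G₁ ⟨ p , div y.x₁ ⟩ ⟨ ℰ₁ , D₁ ⟩) exc₁ (proj₁ y≤x)
             , ≈PD-trans {Γ} (σ-cong v0 {⟨ ℰ₁ ─ ⁅ e ⁆ , div y.x₁ ⟩} {y₁ = y.x₁} (sym exc₁ , λ _ → refl)
                                          x₂≈y₂)
                             (gluing⇒≈σ y.isGluing)
    where
    module y = Restriction sd q̄
    s₁ : SupportedOn G₁ ⟨ ℰ₁ , D₁ ⟩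
    s₁ = IsQD⇒SupportedOn q₁
    s₂ : SupportedOn G₂ ⟨ ℰ₂ , D₂ ⟩
    s₂ = IsQD⇒SupportedOn q₂
    gx : IsGluing v0 ⟨ ℰ , D ⟩ ⟨ ℰ₁ , D₁ ⟩ ⟨ ℰ₂ , D₂ ⟩
    gx = gluing-resp-≈ σx≈x (σ-isGluing v0 _ _)
    y≤x : PDLeq G₁ y.x₁ ⟨ ℰ₁ , D₁ ⟩ × PDLeq G₂ y.x₂ ⟨ ℰ₂ , D₂ ⟩
    y≤x = gluing-reflects-≤ y.isGluing gx y.x₁-isQD y.x₂-isQD q₁ q₂ x̄≤x
    exc₁ : (ℰ ─ ⁅ e ⁆) ∩ Es G₁ ≡ ℰ₁ ─ ⁅ e ⁆
    exc₁ = trans (─-∩-comm ℰ ⁅ e ⁆ (Es G₁)) (cong (_─ ⁅ e ⁆) (GluingSide.exc-∩ sd s₁ s₂ gx))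
    exc₂ : (ℰ ─ ⁅ e ⁆) ∩ Es G₂ ≡ ℰ₂
    exc₂ = trans (─-∩-disjoint ℰ ⁅ e ⁆ (Es G₂) e∉E₂) (GluingSide.exc-∩ (swapSplit sd) s₂ s₁ (gluing-swap gx))
      where
      e∉E₂ : ∀ {i} → i ∈ Es G₂ → i ∉ ⁅ e ⁆
      e∉E₂ i∈E₂ i∈⁅e⁆ = E-disjoint sd e∈E₁ (subst (_∈ Es G₂) (x∈⁅y⁆⇒x≡y e i∈⁅e⁆) i∈E₂)
    x₂≈y₂ : ⟨ ℰ₂ , D₂ ⟩ ≈PD y.x₂
    x₂≈y₂ = ≈PD-sym {Γ} (PDLeq-same-exc⇒≈ y.supported₂ s₂ exc₂ (proj₂ y≤x))

proposition5p20 :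
    (Γ : Graph) (v0 : Fin (nV Γ)) (G₁ G₂ : Subgraph Γ) →
    IsArticulation Γ v0 → IsSplit Γ v0 G₁ G₂ →
    -- σ maps QD_{v0}(Γ₁) × QD_{v0}(Γ₂) into QD_{v0}(Γ)
    (∀ x₁ x₂ → IsQD G₁ v0 x₁ → IsQD G₂ v0 x₂ → IsQD (whole Γ) v0 (σ Γ v0 x₁ x₂))
    -- σ is injective
    × (∀ x₁ x₂ y₁ y₂ → IsQD G₁ v0 x₁ → IsQD G₂ v0 x₂ → IsQD G₁ v0 y₁ → IsQD G₂ v0 y₂ →
         σ Γ v0 x₁ x₂ ≈PD σ Γ v0 y₁ y₂ → (x₁ ≈PD y₁) × (x₂ ≈PD y₂))
    -- σ is surjective
    × (∀ x → IsQD (whole Γ) v0 x →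
         ∃[ x₁ ] ∃[ x₂ ] (IsQD G₁ v0 x₁ × IsQD G₂ v0 x₂ × (σ Γ v0 x₁ x₂ ≈PD x)))
    -- σ preserves and reflects the order (product order on the source)
    × (∀ x₁ x₂ y₁ y₂ → IsQD G₁ v0 x₁ → IsQD G₂ v0 x₂ → IsQD G₁ v0 y₁ → IsQD G₂ v0 y₂ →
         (PDLeq (whole Γ) (σ Γ v0 x₁ x₂) (σ Γ v0 y₁ y₂) ⇔ (PDLeq G₁ x₁ y₁ × PDLeq G₂ x₂ y₂)))
    -- Moreover part
    × (∀ e → e ∈ Es G₁ → (ℰ ℰ₁ ℰ₂ : Subset (nE Γ)) (D D₁ D₂ D̄ : Fin (nV Γ) → ℤ) →
         IsQD (whole Γ) v0 ⟨ ℰ , D ⟩ → e ∈ ℰ →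
         IsQD G₁ v0 ⟨ ℰ₁ , D₁ ⟩ → IsQD G₂ v0 ⟨ ℰ₂ , D₂ ⟩ →
         σ Γ v0 ⟨ ℰ₁ , D₁ ⟩ ⟨ ℰ₂ , D₂ ⟩ ≈PD ⟨ ℰ , D ⟩ →
         IsQD (whole Γ) v0 ⟨ ℰ ─ ⁅ e ⁆ , D̄ ⟩ →
         PDLeq (whole Γ) ⟨ ℰ ─ ⁅ e ⁆ , D̄ ⟩ ⟨ ℰ , D ⟩ →
         Σ (Fin (nV Γ) → ℤ) λ D̄₁ → (IsQD G₁ v0 ⟨ ℰ₁ ─ ⁅ e ⁆ , D̄₁ ⟩
                  × PDLeq G₁ ⟨ ℰ₁ ─ ⁅ e ⁆ , D̄₁ ⟩ ⟨ ℰ₁ , D₁ ⟩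
                  × (σ Γ v0 ⟨ ℰ₁ ─ ⁅ e ⁆ , D̄₁ ⟩ ⟨ ℰ₂ , D₂ ⟩ ≈PD ⟨ ℰ ─ ⁅ e ⁆ , D̄ ⟩)))
proposition5p20 Γ v0 G₁ G₂ _ split =
  σ-isQD sd , σ-injective sd , σ-surjective sd , σ-≤-iff sd ,
  λ e e∈E₁ ℰ ℰ₁ ℰ₂ D D₁ D₂ D̄ _ _ → σ-deletion sd e∈E₁ {ℰ} {ℰ₁} {ℰ₂} {D} {D₁} {D₂} {D̄}
  where
  sd : SplitData Γ v0 G₁ G₂
  sd = splitData split
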